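{- For all (untyped) $\lambda\mu$T-terms $t_1,t_2,t_3$: if $t_1\to_B t_2\to_A t_3$, then there exists a term $t_4$ with $t_1\to_A t_4$ and $t_4\twoheadrightarrow_{AB}t_3$.
   Context: $\lambda\mu$T raw terms/commands: $t,r,s ::= x\mid\lambda x.r\mid ts\mid\mu\alpha.c\mid0\mid\mathsf S\,t\mid\mathsf{nrec}\ r\ s\ t$, $c::=[\alpha]t$ ($x$ $\lambda$-variables, $\alpha$ $\mu$-variables); $\mathrm{FCV}$: free $\mu$-variables; $\overline n:=\mathsf S^n0$. Contexts $E ::= \Box \mid E\,t \mid \mathsf S\,E \mid \mathsf{nrec}\ r\ s\ E$; structural substitution $t[\alpha:=\beta E]$ replaces recursively each subcommand $[\alpha]q$ by $[\beta]E[q[\alpha:=\beta E]]$ (capture-avoiding). $\to_A$ is the compatible closure (on terms and commands) of: $(\lambda x.t)r \to t[x:=r]$; $\mathsf S(\mu\alpha.c)\to \mu\alpha.c[\alpha:=\alpha(\mathsf S\Box)]$; $(\mu\alpha.c)s\to\mu\alpha.c[\alpha:=\alpha(\Box s)]$; $\mathsf{nrec}\ r\ s\ 0\to r$; $\mathsf{nrec}\ r\ s\ (\mathsf S\,\overline n)\to s\ \overline n\ (\mathsf{nrec}\ r\ s\ \overline n)$; $\mathsf{nrec}\ r\ s\ (\mu\alpha.c)\to\mu\alpha.c[\alpha:=\alpha(\mathsf{nrec}\ r\ s\ \Box)]$. $\to_B$ is the compatible closure of $\mu\alpha.[\alpha]t\to t$ if $\alpha\notin\mathrm{FCV}(t)$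 and $[\alpha]\mu\beta.c\to c[\beta:=\alpha\,\Box]$. $\to_{AB}:=\to_A\cup\to_B$ and $\twoheadrightarrow_{AB}$ is its reflexive–transitive closure. -}

module Defs where

-- Untyped λμT with de Bruijn indices, two separate index spaces:
-- λ-variables (var n) and μ-variables (the n in ⟨ n ⟩ t).
open import Data.Nat using (ℕ; zero; suc; pred)
open import Data.Product using (_×_; _,_; proj₁; proj₂)
open import Relation.Nullary using (¬_)
open import Relation.Binary.Construct.Closure.ReflexiveTransitive using (Star)

infixl 7 _·_

mutual
  data Term : Set where
    var  : ℕ → Term
    lam  : Term → Term
    _·_  : Term → Term → Term
    mu   : Cmd → Term
    Z    : Term
    S    : Term → Term
    nrec : Term → Term → Term → Term

  data Cmd : Set where
    ⟨_⟩_ : ℕ → Term → Cmd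

num : ℕ → Term
num zero    = Z
num (suc n) = S (num n)

data Ctx : Set where
  □     : Ctx
  appE  : Ctx → Term → Ctx
  sucE  : Ctx → Ctx
  nrecE : Term → Term → Ctx → Ctx

plug : Ctx → Term → Term
plug □ q = q
plug (appE E t) q = plug E q · t
plug (sucE E) q = S (plug E q)
plug (nrecE r s E) q = nrec r s (plug E q)

ext : (ℕ → ℕ) → ℕ → ℕ
ext ρ zero = zero
ext ρ (suc n) = suc (ρ n)

mutual
  renλ : (ℕ → ℕ) → Term → Term
  renλ ρ (var n) = var (ρ n)
  renλ ρ (lam t) = lam (renλ (ext ρ) t)
  renλ ρ (t · s) = renλ ρ t · renλ ρ s
  renλ ρ (mu c) = mu (renλc ρ c)
  renλ ρ Z = Z
  renλ ρ (S t) = S (renλ ρ t)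
  renλ ρ (nrec r s t) = nrec (renλ ρ r) (renλ ρ s) (renλ ρ t)

  renλc : (ℕ → ℕ) → Cmd → Cmd
  renλc ρ (⟨ α ⟩ t) = ⟨ α ⟩ renλ ρ t

mutual
  renμ : (ℕ → ℕ) → Term → Term
  renμ ρ (var n) = var n
  renμ ρ (lam t) = lam (renμ ρ t)
  renμ ρ (t · s) = renμ ρ t · renμ ρ s
  renμ ρ (mu c) = mu (renμc (ext ρ) c)
  renμ ρ Z = Z
  renμ ρ (S t) = S (renμ ρ t)
  renμ ρ (nrec r s t) = nrec (renμ ρ r) (renμ ρ s) (renμ ρ t)

  renμc : (ℕ → ℕ) → Cmd → Cmd
  renμc ρ (⟨ α ⟩ t) = ⟨ ρ α ⟩ renμ ρ t

renλE : (ℕ → ℕ) → Ctx → Ctx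
renλE ρ □ = □
renλE ρ (appE E t) = appE (renλE ρ E) (renλ ρ t)
renλE ρ (sucE E) = sucE (renλE ρ E)
renλE ρ (nrecE r s E) = nrecE (renλ ρ r) (renλ ρ s) (renλE ρ E)

renμE : (ℕ → ℕ) → Ctx → Ctx
renμE ρ □ = □
renμE ρ (appE E t) = appE (renμE ρ E) (renμ ρ t)
renμE ρ (sucE E) = sucE (renμE ρ E)
renμE ρ (nrecE r s E) = nrecE (renμ ρ r) (renμ ρ s) (renμE ρ E)

mutual
  sub : (ℕ → Term) → Term → Term
  sub σ (var n) = σ n
  sub σ (lam t) = lam (sub (exts σ) t)
  sub σ (t · s) = sub σ t · sub σ s
  sub σ (mu c) = mu (subc (λ n → renμ suc (σ n)) c)
  sub σ Z = Z
  sub σ (S t) = S (sub σ t)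
  sub σ (nrec r s t) = nrec (sub σ r) (sub σ s) (sub σ t)

  subc : (ℕ → Term) → Cmd → Cmd
  subc σ (⟨ α ⟩ t) = ⟨ α ⟩ sub σ t

  exts : (ℕ → Term) → ℕ → Term
  exts σ zero = var zero
  exts σ (suc n) = renλ suc (σ n)

-- t[0 := r]   (β-substitution for λ-index 0, removing the binder)
sub0 : Term → ℕ → Term
sub0 r zero = r
sub0 r (suc n) = var n

-- Parallel structural substitution: μ-variable j is sent to (β , E),
-- and every subcommand [j]q becomes [β]E[q{σ}].  The paper's
-- c[α:=βE] is the instance σ α = (β , E), σ j = (j , □) otherwise.
SSub : Set
SSub = ℕ → ℕ × Ctx

liftμ : SSub → SSub
liftμ σ zero = zero , □
liftμ σ (suc j) = suc (proj₁ (σ j)) , renμE suc (proj₂ (σ j))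

liftλ : SSub → SSub
liftλ σ j = proj₁ (σ j) , renλE suc (proj₂ (σ j))

mutual
  ssub : SSub → Term → Term
  ssub σ (var n) = var n
  ssub σ (lam t) = lam (ssub (liftλ σ) t)
  ssub σ (t · s) = ssub σ t · ssub σ s
  ssub σ (mu c) = mu (ssubc (liftμ σ) c)
  ssub σ Z = Z
  ssub σ (S t) = S (ssub σ t)
  ssub σ (nrec r s t) = nrec (ssub σ r) (ssub σ s) (ssub σ t)

  ssubc : SSub → Cmd → Cmd
  ssubc σ (⟨ j ⟩ q) = ⟨ proj₁ (σ j) ⟩ plug (proj₂ (σ j)) (ssub σ q)

-- For a μ-abstraction body c (μ-index 0 bound):  c[0 := 0 E]  where E
-- lives outside the binder (hence shifted by one on μ-variables).
-- Used by the rules  μα.c ↦ μα.c[α:=α E].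
keepE : Ctx → SSub
keepE E zero = zero , renμE suc E
keepE E (suc j) = suc j , □

-- c[β:=α□] followed by removal of the μβ binder (μ-index 0).
renameTo : ℕ → SSub
renameTo α zero = α , □
renameTo α (suc j) = j , □

mutual
  data _∈FCV_ : ℕ → Term → Set where
    fcv-lam   : ∀ {α t} → α ∈FCV t → α ∈FCV lam t
    fcv-appl  : ∀ {α t s} → α ∈FCV t → α ∈FCV (t · s)
    fcv-appr  : ∀ {α t s} → α ∈FCV s → α ∈FCV (t · s)
    fcv-mu    : ∀ {α c} → suc α ∈FCVc c → α ∈FCV mu c
    fcv-S     : ∀ {α t} → α ∈FCV t → α ∈FCV S t
    fcv-nrec1 : ∀ {α r s t} → α ∈FCV r → α ∈FCV nrec r s t
    fcv-nrec2 : ∀ {α r s t} → α ∈FCV s → α ∈FCV nrec r s t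
    fcv-nrec3 : ∀ {α r s t} → α ∈FCV t → α ∈FCV nrec r s t

  data _∈FCVc_ : ℕ → Cmd → Set where
    fcv-head : ∀ {α t} → α ∈FCVc (⟨ α ⟩ t)
    fcv-body : ∀ {α β t} → α ∈FCV t → α ∈FCVc (⟨ β ⟩ t)

infix 4 _→A_ _→Ac_ _→B_ _→Bc_ _→AB_ _↠AB_

mutual
  data _→A_ : Term → Term → Set where
    β-rule    : ∀ {t r} → lam t · r →A sub (sub0 r) t
    μS        : ∀ {c} → S (mu c) →A mu (ssubc (keepE (sucE □)) c)
    μapp      : ∀ {c s} → mu c · s →A mu (ssubc (keepE (appE □ s)) c)
    nrec-0    : ∀ {r s} → nrec r s Z →A r
    nrec-S    : ∀ {r s} n → nrec r s (S (num n)) →A (s · num n) · nrec r s (num n)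
    nrec-μ    : ∀ {r s c} → nrec r s (mu c) →A mu (ssubc (keepE (nrecE r s □)) c)
    c-lam     : ∀ {t t'} → t →A t' → lam t →A lam t'
    c-appl    : ∀ {t t' s} → t →A t' → t · s →A t' · s
    c-appr    : ∀ {t s s'} → s →A s' → t · s →A t · s'
    c-mu      : ∀ {c c'} → c →Ac c' → mu c →A mu c'
    c-S       : ∀ {t t'} → t →A t' → S t →A S t'
    c-nrec1   : ∀ {r r' s t} → r →A r' → nrec r s t →A nrec r' s t
    c-nrec2   : ∀ {r s s' t} → s →A s' → nrec r s t →A nrec r s' t
    c-nrec3   : ∀ {r s t t'} → t →A t' → nrec r s t →A nrec r s t'

  data _→Ac_ : Cmd → Cmd → Set where
    c-cmd : ∀ {α t t'} → t →A t' → ⟨ α ⟩ t →Ac ⟨ α ⟩ t'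

mutual
  data _→B_ : Term → Term → Set where
    μη        : ∀ {t} → ¬ (zero ∈FCV t) → mu (⟨ zero ⟩ t) →B renμ pred t
    c-lam     : ∀ {t t'} → t →B t' → lam t →B lam t'
    c-appl    : ∀ {t t' s} → t →B t' → t · s →B t' · s
    c-appr    : ∀ {t s s'} → s →B s' → t · s →B t · s'
    c-mu      : ∀ {c c'} → c →Bc c' → mu c →B mu c'
    c-S       : ∀ {t t'} → t →B t' → S t →B S t'
    c-nrec1   : ∀ {r r' s t} → r →B r' → nrec r s t →B nrec r' s t
    c-nrec2   : ∀ {r s s' t} → s →B s' → nrec r s t →B nrec r s' t
    c-nrec3   : ∀ {r s t t'} → t →B t' → nrec r s t →B nrec r s t'

  data _→Bc_ : Cmd → Cmd → Set where
    μμ    : ∀ {α c} → ⟨ α ⟩ mu c →Bc ssubc (renameTo α) c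
    c-cmd : ∀ {α t t'} → t →B t' → ⟨ α ⟩ t →Bc ⟨ α ⟩ t'

data _→AB_ (t t' : Term) : Set where
  stepA : t →A t' → t →AB t'
  stepB : t →B t' → t →AB t'

_↠AB_ : Term → Term → Set
_↠AB_ = Star _→AB_

-- Steps at disjoint positions commute.  If the A-step happens inside
-- the B-contractum, it is reflected back to t₁: the B-rules only rename
-- μ-variables of their body, and A-redexes are invariant under renaming
-- (reflect-A).  If the B-step happens inside an argument that an A-rule
-- copies or moves, it is transported along substitution (sub-↠B,
-- keepE-↠B, ssub-B).  The remaining critical pairs, where the B-step
-- creates the A-redex, are closed explicitly (critical-frame, critical-β,
-- critical-zero, critical-succ).
module Submission where

open import Defs
open import Data.Product using (Σ; _×_; _,_; proj₁; proj₂)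
open import Data.Nat using (ℕ; zero; suc; pred)
open import Data.Nat.Properties using (suc-injective)
open import Data.Sum using (_⊎_; inj₁; inj₂)
open import Data.Empty using (⊥-elim)
open import Relation.Nullary using (¬_)
open import Relation.Binary.PropositionalEquality
open import Relation.Binary.Construct.Closure.ReflexiveTransitive using (Star; ε; _◅_; _◅◅_; gmap)

cong-nrec : ∀ {r r' s s' t t'} → r ≡ r' → s ≡ s' → t ≡ t' → nrec r s t ≡ nrec r' s' t'
cong-nrec refl refl refl = refl

cong-nrecE : ∀ {r r' s s' E E'} → r ≡ r' → s ≡ s' → E ≡ E' → nrecE r s E ≡ nrecE r' s' E'
cong-nrecE refl refl refl = refl

mapE : (Term → Term) → Ctx → Ctx
mapE f □ = □
mapE f (appE E t) = appE (mapE f E) (f t)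
mapE f (sucE E) = sucE (mapE f E)
mapE f (nrecE r s E) = nrecE (f r) (f s) (mapE f E)

mapE-fuse : ∀ {f g h} → (∀ x → f (g x) ≡ h x) → ∀ E → mapE f (mapE g E) ≡ mapE h E
mapE-fuse e □ = refl
mapE-fuse e (appE E t) = cong₂ appE (mapE-fuse e E) (e t)
mapE-fuse e (sucE E) = cong sucE (mapE-fuse e E)
mapE-fuse e (nrecE r s E) = cong-nrecE (e r) (e s) (mapE-fuse e E)

mapE-id : ∀ {f} → (∀ x → f x ≡ x) → ∀ E → mapE f E ≡ E
mapE-id e □ = refl
mapE-id e (appE E t) = cong₂ appE (mapE-id e E) (e t)
mapE-id e (sucE E) = cong sucE (mapE-id e E)
mapE-id e (nrecE r s E) = cong-nrecE (e r) (e s) (mapE-id e E)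

mapE-square : ∀ {f g h k} → (∀ x → f (g x) ≡ h (k x)) → ∀ E → mapE f (mapE g E) ≡ mapE h (mapE k E)
mapE-square e E = trans (mapE-fuse e E) (sym (mapE-fuse (λ _ → refl) E))

renμE-map : ∀ ρ E → renμE ρ E ≡ mapE (renμ ρ) E
renμE-map ρ □ = refl
renμE-map ρ (appE E t) = cong (λ F → appE F (renμ ρ t)) (renμE-map ρ E)
renμE-map ρ (sucE E) = cong sucE (renμE-map ρ E)
renμE-map ρ (nrecE r s E) = cong (nrecE _ _) (renμE-map ρ E)

renλE-map : ∀ ρ E → renλE ρ E ≡ mapE (renλ ρ) E
renλE-map ρ □ = refl
renλE-map ρ (appE E t) = cong (λ F → appE F (renλ ρ t)) (renλE-map ρ E)
renλE-map ρ (sucE E) = cong sucE (renλE-map ρ E)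
renλE-map ρ (nrecE r s E) = cong (nrecE _ _) (renλE-map ρ E)

ssubE : SSub → Ctx → Ctx
ssubE σ = mapE (ssub σ)

infixr 6 _⊚_
_⊚_ : Ctx → Ctx → Ctx
□ ⊚ G = G
appE F t ⊚ G = appE (F ⊚ G) t
sucE F ⊚ G = sucE (F ⊚ G)
nrecE r s F ⊚ G = nrecE r s (F ⊚ G)

plug-⊚ : ∀ F G q → plug (F ⊚ G) q ≡ plug F (plug G q)
plug-⊚ □ G q = refl
plug-⊚ (appE F t) G q = cong (_· t) (plug-⊚ F G q)
plug-⊚ (sucE F) G q = cong S (plug-⊚ F G q)
plug-⊚ (nrecE r s F) G q = cong (nrec r s) (plug-⊚ F G q)

⊚-□ : ∀ F → F ⊚ □ ≡ F
⊚-□ □ = refl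
⊚-□ (appE F t) = cong (λ G → appE G t) (⊚-□ F)
⊚-□ (sucE F) = cong sucE (⊚-□ F)
⊚-□ (nrecE r s F) = cong (nrecE r s) (⊚-□ F)

mapE-⊚ : ∀ f F G → mapE f (F ⊚ G) ≡ mapE f F ⊚ mapE f G
mapE-⊚ f □ G = refl
mapE-⊚ f (appE F t) G = cong (λ H → appE H (f t)) (mapE-⊚ f F G)
mapE-⊚ f (sucE F) G = cong sucE (mapE-⊚ f F G)
mapE-⊚ f (nrecE r s F) G = cong (nrecE _ _) (mapE-⊚ f F G)

renμ-plug : ∀ ρ E q → renμ ρ (plug E q) ≡ plug (renμE ρ E) (renμ ρ q)
renμ-plug ρ □ q = refl
renμ-plug ρ (appE E t) q = cong (_· renμ ρ t) (renμ-plug ρ E q)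
renμ-plug ρ (sucE E) q = cong S (renμ-plug ρ E q)
renμ-plug ρ (nrecE r s E) q = cong (nrec _ _) (renμ-plug ρ E q)

renλ-plug : ∀ ρ E q → renλ ρ (plug E q) ≡ plug (renλE ρ E) (renλ ρ q)
renλ-plug ρ □ q = refl
renλ-plug ρ (appE E t) q = cong (_· renλ ρ t) (renλ-plug ρ E q)
renλ-plug ρ (sucE E) q = cong S (renλ-plug ρ E q)
renλ-plug ρ (nrecE r s E) q = cong (nrec _ _) (renλ-plug ρ E q)

ssub-plug : ∀ σ E q → ssub σ (plug E q) ≡ plug (ssubE σ E) (ssub σ q)
ssub-plug σ □ q = refl
ssub-plug σ (appE E t) q = cong (_· ssub σ t) (ssub-plug σ E q)
ssub-plug σ (sucE E) q = cong S (ssub-plug σ E q)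
ssub-plug σ (nrecE r s E) q = cong (nrec _ _) (ssub-plug σ E q)

-- Identity and composition laws for renamings.  All traversal lemmas
-- take pointwise hypotheses, so that they can be instantiated under binders.
mutual
  renμ-id : ∀ {ρ} → (∀ j → ρ j ≡ j) → ∀ t → renμ ρ t ≡ t
  renμ-id h (var n) = refl
  renμ-id h (lam t) = cong lam (renμ-id h t)
  renμ-id h (t · s) = cong₂ _·_ (renμ-id h t) (renμ-id h s)
  renμ-id h (mu c) = cong mu (renμc-id (λ { zero → refl ; (suc j) → cong suc (h j) }) c)
  renμ-id h Z = refl
  renμ-id h (S t) = cong S (renμ-id h t)
  renμ-id h (nrec r s t) = cong-nrec (renμ-id h r) (renμ-id h s) (renμ-id h t)

  renμc-id : ∀ {ρ} → (∀ j → ρ j ≡ j) → ∀ c → renμc ρ c ≡ c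
  renμc-id h (⟨ α ⟩ t) = cong₂ ⟨_⟩_ (h α) (renμ-id h t)

mutual
  renλ-renλ : ∀ {ρ ρ' ρ''} → (∀ j → ρ (ρ' j) ≡ ρ'' j) → ∀ t → renλ ρ (renλ ρ' t) ≡ renλ ρ'' t
  renλ-renλ h (var n) = cong var (h n)
  renλ-renλ h (lam t) = cong lam (renλ-renλ (λ { zero → refl ; (suc j) → cong suc (h j) }) t)
  renλ-renλ h (t · s) = cong₂ _·_ (renλ-renλ h t) (renλ-renλ h s)
  renλ-renλ h (mu c) = cong mu (renλc-renλc h c)
  renλ-renλ h Z = refl
  renλ-renλ h (S t) = cong S (renλ-renλ h t)
  renλ-renλ h (nrec r s t) = cong-nrec (renλ-renλ h r) (renλ-renλ h s) (renλ-renλ h t)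

  renλc-renλc : ∀ {ρ ρ' ρ''} → (∀ j → ρ (ρ' j) ≡ ρ'' j) → ∀ c → renλc ρ (renλc ρ' c) ≡ renλc ρ'' c
  renλc-renλc h (⟨ α ⟩ t) = cong (⟨ α ⟩_) (renλ-renλ h t)

-- λ-renamings and μ-renamings act on disjoint index spaces, hence commute.
mutual
  renλ-renμ : ∀ ρ ρ' t → renλ ρ (renμ ρ' t) ≡ renμ ρ' (renλ ρ t)
  renλ-renμ ρ ρ' (var n) = refl
  renλ-renμ ρ ρ' (lam t) = cong lam (renλ-renμ (ext ρ) ρ' t)
  renλ-renμ ρ ρ' (t · s) = cong₂ _·_ (renλ-renμ ρ ρ' t) (renλ-renμ ρ ρ' s)
  renλ-renμ ρ ρ' (mu c) = cong mu (renλc-renμc ρ (ext ρ') c)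
  renλ-renμ ρ ρ' Z = refl
  renλ-renμ ρ ρ' (S t) = cong S (renλ-renμ ρ ρ' t)
  renλ-renμ ρ ρ' (nrec r s t) = cong-nrec (renλ-renμ ρ ρ' r) (renλ-renμ ρ ρ' s) (renλ-renμ ρ ρ' t)

  renλc-renμc : ∀ ρ ρ' c → renλc ρ (renμc ρ' c) ≡ renμc ρ' (renλc ρ c)
  renλc-renμc ρ ρ' (⟨ α ⟩ t) = cong (⟨ ρ' α ⟩_) (renλ-renμ ρ ρ' t)

entryCmd : ℕ × Ctx → Term → Cmd
entryCmd (β , E) x = ⟨ β ⟩ plug E x

shiftλ-entry : ℕ × Ctx → ℕ × Ctx
shiftλ-entry e = proj₁ e , renλE suc (proj₂ e)

shiftμ-entry : ℕ × Ctx → ℕ × Ctx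
shiftμ-entry e = suc (proj₁ e) , renμE suc (proj₂ e)

mutual
  ssub-cong-FCV : ∀ {σ σ'} t → (∀ j → j ∈FCV t → σ j ≡ σ' j) → ssub σ t ≡ ssub σ' t
  ssub-cong-FCV (var n) h = refl
  ssub-cong-FCV (lam t) h = cong lam (ssub-cong-FCV t (λ j p → cong shiftλ-entry (h j (fcv-lam p))))
  ssub-cong-FCV (t · s) h = cong₂ _·_ (ssub-cong-FCV t (λ j p → h j (fcv-appl p))) (ssub-cong-FCV s (λ j p → h j (fcv-appr p)))
  ssub-cong-FCV {σ} {σ'} (mu c) h = cong mu (ssubc-cong-FCV c lifted)
    where lifted : ∀ j → j ∈FCVc c → liftμ σ j ≡ liftμ σ' j
          lifted zero p = refl
          lifted (suc j) p = cong shiftμ-entry (h j (fcv-mu p))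
  ssub-cong-FCV Z h = refl
  ssub-cong-FCV (S t) h = cong S (ssub-cong-FCV t (λ j p → h j (fcv-S p)))
  ssub-cong-FCV (nrec r s t) h = cong-nrec (ssub-cong-FCV r (λ j p → h j (fcv-nrec1 p)))
     (ssub-cong-FCV s (λ j p → h j (fcv-nrec2 p))) (ssub-cong-FCV t (λ j p → h j (fcv-nrec3 p)))

  ssubc-cong-FCV : ∀ {σ σ'} c → (∀ j → j ∈FCVc c → σ j ≡ σ' j) → ssubc σ c ≡ ssubc σ' c
  ssubc-cong-FCV (⟨ α ⟩ t) h = cong₂ entryCmd (h α fcv-head) (ssub-cong-FCV t (λ j p → h j (fcv-body p)))

ssubc-cong : ∀ {σ σ'} → (∀ j → σ j ≡ σ' j) → ∀ c → ssubc σ c ≡ ssubc σ' c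
ssubc-cong h c = ssubc-cong-FCV c (λ j _ → h j)

mutual
  ssub-renaming : ∀ {σ ρ} → (∀ j → σ j ≡ (ρ j , □)) → ∀ t → ssub σ t ≡ renμ ρ t
  ssub-renaming h (var n) = refl
  ssub-renaming h (lam t) = cong lam (ssub-renaming (λ j → cong shiftλ-entry (h j)) t)
  ssub-renaming h (t · s) = cong₂ _·_ (ssub-renaming h t) (ssub-renaming h s)
  ssub-renaming {σ} {ρ} h (mu c) = cong mu (ssubc-renaming lifted c)
    where lifted : ∀ j → liftμ σ j ≡ (ext ρ j , □)
          lifted zero = refl
          lifted (suc j) = cong shiftμ-entry (h j)
  ssub-renaming h Z = refl
  ssub-renaming h (S t) = cong S (ssub-renaming h t)
  ssub-renaming h (nrec r s t) = cong-nrec (ssub-renaming h r) (ssub-renaming h s) (ssub-renaming h t)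

  ssubc-renaming : ∀ {σ ρ} → (∀ j → σ j ≡ (ρ j , □)) → ∀ c → ssubc σ c ≡ renμc ρ c
  ssubc-renaming h (⟨ α ⟩ t) = cong₂ entryCmd (h α) (ssub-renaming h t)

ssub-id : ∀ {σ} → (∀ j → σ j ≡ (j , □)) → ∀ t → ssub σ t ≡ t
ssub-id h t = trans (ssub-renaming h t) (renμ-id (λ j → refl) t)

ssubc-id : ∀ {σ} → (∀ j → σ j ≡ (j , □)) → ∀ c → ssubc σ c ≡ c
ssubc-id h c = trans (ssubc-renaming h c) (renμc-id (λ j → refl) c)

mutual
  ssub-renμ : ∀ {σ ρ θ} → (∀ j → σ (ρ j) ≡ θ j) → ∀ t → ssub σ (renμ ρ t) ≡ ssub θ t
  ssub-renμ h (var n) = refl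
  ssub-renμ h (lam t) = cong lam (ssub-renμ (λ j → cong shiftλ-entry (h j)) t)
  ssub-renμ h (t · s) = cong₂ _·_ (ssub-renμ h t) (ssub-renμ h s)
  ssub-renμ {σ} {ρ} {θ} h (mu c) = cong mu (ssubc-renμc lifted c)
    where lifted : ∀ j → liftμ σ (ext ρ j) ≡ liftμ θ j
          lifted zero = refl
          lifted (suc j) = cong shiftμ-entry (h j)
  ssub-renμ h Z = refl
  ssub-renμ h (S t) = cong S (ssub-renμ h t)
  ssub-renμ h (nrec r s t) = cong-nrec (ssub-renμ h r) (ssub-renμ h s) (ssub-renμ h t)

  ssubc-renμc : ∀ {σ ρ θ} → (∀ j → σ (ρ j) ≡ θ j) → ∀ c → ssubc σ (renμc ρ c) ≡ ssubc θ c
  ssubc-renμc h (⟨ α ⟩ t) = cong₂ entryCmd (h α) (ssub-renμ h t)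

renμ-renμ : ∀ {ρ ρ' ρ''} → (∀ j → ρ (ρ' j) ≡ ρ'' j) → ∀ t → renμ ρ (renμ ρ' t) ≡ renμ ρ'' t
renμ-renμ {ρ} {ρ'} {ρ''} h t = begin
  renμ ρ (renμ ρ' t)                  ≡⟨ sym (ssub-renaming (λ _ → refl) (renμ ρ' t)) ⟩
  ssub (λ j → ρ j , □) (renμ ρ' t)    ≡⟨ ssub-renμ (λ j → cong (_, □) (h j)) t ⟩
  ssub (λ j → ρ'' j , □) t            ≡⟨ ssub-renaming (λ _ → refl) t ⟩
  renμ ρ'' t                          ∎
  where open ≡-Reasoning

renμ-unshift : ∀ {ρ} → (∀ j → ρ (suc j) ≡ j) → ∀ t → renμ ρ (renμ suc t) ≡ t
renμ-unshift h t = trans (renμ-renμ h t) (renμ-id (λ j → refl) t)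

renμ-pred-suc : ∀ t → renμ pred (renμ suc t) ≡ t
renμ-pred-suc = renμ-unshift (λ _ → refl)

renμ-cong-FCV : ∀ {ρ ρ'} t → (∀ j → j ∈FCV t → ρ j ≡ ρ' j) → renμ ρ t ≡ renμ ρ' t
renμ-cong-FCV t h = trans (sym (ssub-renaming (λ j → refl) t))
  (trans (ssub-cong-FCV t (λ j p → cong (_, □) (h j p))) (ssub-renaming (λ j → refl) t))

renμE-renμE : ∀ {ρ ρ' ρ''} → (∀ j → ρ (ρ' j) ≡ ρ'' j) → ∀ E → renμE ρ (renμE ρ' E) ≡ renμE ρ'' E
renμE-renμE {ρ} {ρ'} {ρ''} h E = begin
  renμE ρ (renμE ρ' E)              ≡⟨ renμE-map ρ _ ⟩
  mapE (renμ ρ) (renμE ρ' E)        ≡⟨ cong (mapE (renμ ρ)) (renμE-map ρ' E) ⟩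
  mapE (renμ ρ) (mapE (renμ ρ') E)  ≡⟨ mapE-fuse (renμ-renμ h) E ⟩
  mapE (renμ ρ'') E                 ≡⟨ sym (renμE-map ρ'' E) ⟩
  renμE ρ'' E                       ∎
  where open ≡-Reasoning

renμE-id : ∀ {ρ} → (∀ j → ρ j ≡ j) → ∀ E → renμE ρ E ≡ E
renμE-id {ρ} h E = trans (renμE-map ρ E) (mapE-id (renμ-id h) E)

renμE-pred-suc : ∀ E → renμE pred (renμE suc E) ≡ E
renμE-pred-suc E = trans (renμE-renμE {ρ'' = λ j → j} (λ j → refl) E) (renμE-id (λ j → refl) E)

renλE-renλE : ∀ {ρ ρ' ρ''} → (∀ j → ρ (ρ' j) ≡ ρ'' j) → ∀ E → renλE ρ (renλE ρ' E) ≡ renλE ρ'' E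
renλE-renλE {ρ} {ρ'} {ρ''} h E = begin
  renλE ρ (renλE ρ' E)              ≡⟨ renλE-map ρ _ ⟩
  mapE (renλ ρ) (renλE ρ' E)        ≡⟨ cong (mapE (renλ ρ)) (renλE-map ρ' E) ⟩
  mapE (renλ ρ) (mapE (renλ ρ') E)  ≡⟨ mapE-fuse (renλ-renλ h) E ⟩
  mapE (renλ ρ'') E                 ≡⟨ sym (renλE-map ρ'' E) ⟩
  renλE ρ'' E                       ∎
  where open ≡-Reasoning

renλE-renμE : ∀ ρ ρ' E → renλE ρ (renμE ρ' E) ≡ renμE ρ' (renλE ρ E)
renλE-renμE ρ ρ' □ = refl
renλE-renμE ρ ρ' (appE E t) = cong₂ appE (renλE-renμE ρ ρ' E) (renλ-renμ ρ ρ' t)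
renλE-renμE ρ ρ' (sucE E) = cong sucE (renλE-renμE ρ ρ' E)
renλE-renμE ρ ρ' (nrecE r s E) = cong-nrecE (renλ-renμ ρ ρ' r) (renλ-renμ ρ ρ' s) (renλE-renμE ρ ρ' E)

renλE-⊚ : ∀ ρ F G → renλE ρ (F ⊚ G) ≡ renλE ρ F ⊚ renλE ρ G
renλE-⊚ ρ F G = trans (renλE-map ρ _) (trans (mapE-⊚ _ F G) (sym (cong₂ _⊚_ (renλE-map ρ F) (renλE-map ρ G))))

renμE-⊚ : ∀ ρ F G → renμE ρ (F ⊚ G) ≡ renμE ρ F ⊚ renμE ρ G
renμE-⊚ ρ F G = trans (renμE-map ρ _) (trans (mapE-⊚ _ F G) (sym (cong₂ _⊚_ (renμE-map ρ F) (renμE-map ρ G))))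

mutual
  renμ-ssub : ∀ {ρ σ θ} → (∀ j → (ρ (proj₁ (σ j)) , renμE ρ (proj₂ (σ j))) ≡ θ j) →
              ∀ t → renμ ρ (ssub σ t) ≡ ssub θ t
  renμ-ssub h (var n) = refl
  renμ-ssub {ρ} {σ} {θ} h (lam t) = cong lam (renμ-ssub lifted t)
    where lifted : ∀ j → (ρ (proj₁ (liftλ σ j)) , renμE ρ (proj₂ (liftλ σ j))) ≡ liftλ θ j
          lifted j = trans (cong (ρ (proj₁ (σ j)) ,_) (sym (renλE-renμE suc ρ (proj₂ (σ j)))))
                           (cong shiftλ-entry (h j))
  renμ-ssub h (t · s) = cong₂ _·_ (renμ-ssub h t) (renμ-ssub h s)
  renμ-ssub {ρ} {σ} {θ} h (mu c) = cong mu (renμc-ssubc lifted c)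
    where lifted : ∀ j → (ext ρ (proj₁ (liftμ σ j)) , renμE (ext ρ) (proj₂ (liftμ σ j))) ≡ liftμ θ j
          lifted zero = refl
          lifted (suc j) = trans (cong (suc (ρ (proj₁ (σ j))) ,_)
                                   (trans (renμE-renμE (λ _ → refl) (proj₂ (σ j)))
                                          (sym (renμE-renμE (λ _ → refl) (proj₂ (σ j))))))
                                 (cong shiftμ-entry (h j))
  renμ-ssub h Z = refl
  renμ-ssub h (S t) = cong S (renμ-ssub h t)
  renμ-ssub h (nrec r s t) = cong-nrec (renμ-ssub h r) (renμ-ssub h s) (renμ-ssub h t)

  renμc-ssubc : ∀ {ρ σ θ} → (∀ j → (ρ (proj₁ (σ j)) , renμE ρ (proj₂ (σ j))) ≡ θ j) →
                ∀ c → renμc ρ (ssubc σ c) ≡ ssubc θ c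
  renμc-ssubc {ρ} {σ} h (⟨ α ⟩ t) =
    trans (cong (⟨ _ ⟩_) (trans (renμ-plug ρ (proj₂ (σ α)) _) (cong (plug _) (renμ-ssub h t))))
          (cong₂ entryCmd (h α) refl)

mutual
  ssub-renλ : ∀ {ρ σ σ'} → (∀ j → (proj₁ (σ j) , renλE ρ (proj₂ (σ j))) ≡ σ' j) →
              ∀ t → ssub σ' (renλ ρ t) ≡ renλ ρ (ssub σ t)
  ssub-renλ h (var n) = refl
  ssub-renλ {ρ} {σ} {σ'} h (lam t) = cong lam (ssub-renλ lifted t)
    where lifted : ∀ j → (proj₁ (liftλ σ j) , renλE (ext ρ) (proj₂ (liftλ σ j))) ≡ liftλ σ' j
          lifted j = trans (cong (proj₁ (σ j) ,_)
                             (trans (renλE-renλE (λ _ → refl) (proj₂ (σ j)))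
                                    (sym (renλE-renλE (λ _ → refl) (proj₂ (σ j))))))
                           (cong shiftλ-entry (h j))
  ssub-renλ h (t · s) = cong₂ _·_ (ssub-renλ h t) (ssub-renλ h s)
  ssub-renλ {ρ} {σ} {σ'} h (mu c) = cong mu (ssubc-renλc lifted c)
    where lifted : ∀ j → (proj₁ (liftμ σ j) , renλE ρ (proj₂ (liftμ σ j))) ≡ liftμ σ' j
          lifted zero = refl
          lifted (suc j) = trans (cong (suc (proj₁ (σ j)) ,_) (renλE-renμE ρ suc (proj₂ (σ j))))
                                 (cong shiftμ-entry (h j))
  ssub-renλ h Z = refl
  ssub-renλ h (S t) = cong S (ssub-renλ h t)
  ssub-renλ h (nrec r s t) = cong-nrec (ssub-renλ h r) (ssub-renλ h s) (ssub-renλ h t)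

  ssubc-renλc : ∀ {ρ σ σ'} → (∀ j → (proj₁ (σ j) , renλE ρ (proj₂ (σ j))) ≡ σ' j) →
                ∀ c → ssubc σ' (renλc ρ c) ≡ renλc ρ (ssubc σ c)
  ssubc-renλc {ρ} {σ} h (⟨ α ⟩ t) =
    trans (cong₂ entryCmd (sym (h α)) (ssub-renλ h t)) (cong (⟨ _ ⟩_) (sym (renλ-plug ρ (proj₂ (σ α)) _)))

ssubE-liftλ : ∀ σ E → ssubE (liftλ σ) (renλE suc E) ≡ renλE suc (ssubE σ E)
ssubE-liftλ σ E = trans (cong (ssubE (liftλ σ)) (renλE-map suc E))
  (trans (mapE-square (ssub-renλ {σ = σ} (λ j → refl)) E) (sym (renλE-map suc _)))

ssubE-liftμ : ∀ σ E → ssubE (liftμ σ) (renμE suc E) ≡ renμE suc (ssubE σ E)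
ssubE-liftμ σ E = trans (cong (ssubE (liftμ σ)) (renμE-map suc E))
  (trans (mapE-square (λ x → trans (ssub-renμ (λ j → refl) x) (sym (renμ-ssub (λ j → refl) x))) E)
         (sym (renμE-map suc _)))

infixl 5 _⊙_
_⊙_ : SSub → SSub → SSub
(σ ⊙ τ) j = proj₁ (σ (proj₁ (τ j))) , proj₂ (σ (proj₁ (τ j))) ⊚ ssubE σ (proj₂ (τ j))

mutual
  ssub-ssub : ∀ {σ τ θ} → (∀ j → (σ ⊙ τ) j ≡ θ j) → ∀ t → ssub σ (ssub τ t) ≡ ssub θ t
  ssub-ssub h (var n) = refl
  ssub-ssub {σ} {τ} {θ} h (lam t) = cong lam (ssub-ssub lifted t)
    where lifted : ∀ j → (liftλ σ ⊙ liftλ τ) j ≡ liftλ θ j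
          lifted j = trans (cong (proj₁ (σ (proj₁ (τ j))) ,_)
                             (trans (cong (renλE suc (proj₂ (σ (proj₁ (τ j)))) ⊚_) (ssubE-liftλ σ (proj₂ (τ j))))
                                    (sym (renλE-⊚ suc (proj₂ (σ (proj₁ (τ j)))) _))))
                           (cong shiftλ-entry (h j))
  ssub-ssub h (t · s) = cong₂ _·_ (ssub-ssub h t) (ssub-ssub h s)
  ssub-ssub {σ} {τ} {θ} h (mu c) = cong mu (ssubc-ssubc lifted c)
    where lifted : ∀ j → (liftμ σ ⊙ liftμ τ) j ≡ liftμ θ j
          lifted zero = refl
          lifted (suc j) = trans (cong (suc (proj₁ (σ (proj₁ (τ j)))) ,_)
                                   (trans (cong (renμE suc (proj₂ (σ (proj₁ (τ j)))) ⊚_) (ssubE-liftμ σ (proj₂ (τ j))))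
                                          (sym (renμE-⊚ suc (proj₂ (σ (proj₁ (τ j)))) _))))
                                 (cong shiftμ-entry (h j))
  ssub-ssub h Z = refl
  ssub-ssub h (S t) = cong S (ssub-ssub h t)
  ssub-ssub h (nrec r s t) = cong-nrec (ssub-ssub h r) (ssub-ssub h s) (ssub-ssub h t)

  ssubc-ssubc : ∀ {σ τ θ} → (∀ j → (σ ⊙ τ) j ≡ θ j) → ∀ c → ssubc σ (ssubc τ c) ≡ ssubc θ c
  ssubc-ssubc {σ} {τ} {θ} h (⟨ α ⟩ q) = begin
    ⟨ _ ⟩ plug F (ssub σ (plug E (ssub τ q)))   ≡⟨ cong (λ x → ⟨ _ ⟩ plug F x) (ssub-plug σ E (ssub τ q)) ⟩
    ⟨ _ ⟩ plug F (plug (ssubE σ E) (ssub σ (ssub τ q))) ≡⟨ cong (⟨ _ ⟩_) (sym (plug-⊚ F (ssubE σ E) _)) ⟩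
    entryCmd ((σ ⊙ τ) α) (ssub σ (ssub τ q))    ≡⟨ cong₂ entryCmd (h α) (ssub-ssub h q) ⟩
    entryCmd (θ α) (ssub θ q)                   ∎
    where F = proj₂ (σ (proj₁ (τ α)))
          E = proj₂ (τ α)
          open ≡-Reasoning

mutual
  renμ-sub : ∀ {ρ σ σ'} → (∀ n → renμ ρ (σ n) ≡ σ' n) → ∀ t → renμ ρ (sub σ t) ≡ sub σ' (renμ ρ t)
  renμ-sub h (var n) = h n
  renμ-sub {ρ} {σ} {σ'} h (lam t) = cong lam (renμ-sub lifted t)
    where lifted : ∀ n → renμ ρ (exts σ n) ≡ exts σ' n
          lifted zero = refl
          lifted (suc n) = trans (sym (renλ-renμ suc ρ (σ n))) (cong (renλ suc) (h n))
  renμ-sub h (t · s) = cong₂ _·_ (renμ-sub h t) (renμ-sub h s)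
  renμ-sub {ρ} {σ} {σ'} h (mu c) = cong mu (renμc-subc lifted c)
    where lifted : ∀ n → renμ (ext ρ) (renμ suc (σ n)) ≡ renμ suc (σ' n)
          lifted n = trans (renμ-renμ (λ j → refl) (σ n))
                       (trans (sym (renμ-renμ (λ j → refl) (σ n))) (cong (renμ suc) (h n)))
  renμ-sub h Z = refl
  renμ-sub h (S t) = cong S (renμ-sub h t)
  renμ-sub h (nrec r s t) = cong-nrec (renμ-sub h r) (renμ-sub h s) (renμ-sub h t)

  renμc-subc : ∀ {ρ σ σ'} → (∀ n → renμ ρ (σ n) ≡ σ' n) → ∀ c → renμc ρ (subc σ c) ≡ subc σ' (renμc ρ c)
  renμc-subc h (⟨ α ⟩ t) = cong (⟨ _ ⟩_) (renμ-sub h t)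

mutual
  FCV-renμ : ∀ {α ρ} t → α ∈FCV renμ ρ t → Σ ℕ λ β → β ∈FCV t × ρ β ≡ α
  FCV-renμ (var n) ()
  FCV-renμ (lam t) (fcv-lam p) with FCV-renμ t p
  ... | β , q , e = β , fcv-lam q , e
  FCV-renμ (t · s) (fcv-appl p) with FCV-renμ t p
  ... | β , q , e = β , fcv-appl q , e
  FCV-renμ (t · s) (fcv-appr p) with FCV-renμ s p
  ... | β , q , e = β , fcv-appr q , e
  FCV-renμ (mu c) (fcv-mu p) with FCV-renμc c p
  ... | zero , q , ()
  ... | suc β , q , e = β , fcv-mu q , suc-injective e
  FCV-renμ Z ()
  FCV-renμ (S t) (fcv-S p) with FCV-renμ t p
  ... | β , q , e = β , fcv-S q , e
  FCV-renμ (nrec r s t) (fcv-nrec1 p) with FCV-renμ r p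
  ... | β , q , e = β , fcv-nrec1 q , e
  FCV-renμ (nrec r s t) (fcv-nrec2 p) with FCV-renμ s p
  ... | β , q , e = β , fcv-nrec2 q , e
  FCV-renμ (nrec r s t) (fcv-nrec3 p) with FCV-renμ t p
  ... | β , q , e = β , fcv-nrec3 q , e

  FCV-renμc : ∀ {α ρ} c → α ∈FCVc renμc ρ c → Σ ℕ λ β → β ∈FCVc c × ρ β ≡ α
  FCV-renμc (⟨ β ⟩ t) fcv-head = β , fcv-head , refl
  FCV-renμc (⟨ β ⟩ t) (fcv-body p) with FCV-renμ t p
  ... | γ , q , e = γ , fcv-body q , e

zero∉FCV-shift : ∀ t → ¬ (0 ∈FCV renμ suc t)
zero∉FCV-shift t p with FCV-renμ t p
... | _ , _ , ()

mutual
  FCV-renλ : ∀ {α ρ} t → α ∈FCV renλ ρ t → α ∈FCV t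
  FCV-renλ (var n) ()
  FCV-renλ (lam t) (fcv-lam p) = fcv-lam (FCV-renλ t p)
  FCV-renλ (t · s) (fcv-appl p) = fcv-appl (FCV-renλ t p)
  FCV-renλ (t · s) (fcv-appr p) = fcv-appr (FCV-renλ s p)
  FCV-renλ (mu c) (fcv-mu p) = fcv-mu (FCV-renλc c p)
  FCV-renλ Z ()
  FCV-renλ (S t) (fcv-S p) = fcv-S (FCV-renλ t p)
  FCV-renλ (nrec r s t) (fcv-nrec1 p) = fcv-nrec1 (FCV-renλ r p)
  FCV-renλ (nrec r s t) (fcv-nrec2 p) = fcv-nrec2 (FCV-renλ s p)
  FCV-renλ (nrec r s t) (fcv-nrec3 p) = fcv-nrec3 (FCV-renλ t p)

  FCV-renλc : ∀ {α ρ} c → α ∈FCVc renλc ρ c → α ∈FCVc c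
  FCV-renλc (⟨ β ⟩ t) fcv-head = fcv-head
  FCV-renλc (⟨ β ⟩ t) (fcv-body p) = fcv-body (FCV-renλ t p)

mutual
  FCV-sub : ∀ {α} σ t → α ∈FCV sub σ t → α ∈FCV t ⊎ Σ ℕ (λ n → α ∈FCV σ n)
  FCV-sub σ (var n) p = inj₂ (n , p)
  FCV-sub σ (lam t) (fcv-lam p) with FCV-sub (exts σ) t p
  ... | inj₁ q = inj₁ (fcv-lam q)
  ... | inj₂ (zero , ())
  ... | inj₂ (suc n , q) = inj₂ (n , FCV-renλ (σ n) q)
  FCV-sub σ (t · s) (fcv-appl p) with FCV-sub σ t p
  ... | inj₁ q = inj₁ (fcv-appl q)
  ... | inj₂ q = inj₂ q
  FCV-sub σ (t · s) (fcv-appr p) with FCV-sub σ s p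
  ... | inj₁ q = inj₁ (fcv-appr q)
  ... | inj₂ q = inj₂ q
  FCV-sub σ (mu c) (fcv-mu p) with FCV-subc (λ n → renμ suc (σ n)) c p
  ... | inj₁ q = inj₁ (fcv-mu q)
  ... | inj₂ (n , q) with FCV-renμ (σ n) q
  ... | β , q' , e = inj₂ (n , subst (_∈FCV σ n) (suc-injective e) q')
  FCV-sub σ Z ()
  FCV-sub σ (S t) (fcv-S p) with FCV-sub σ t p
  ... | inj₁ q = inj₁ (fcv-S q)
  ... | inj₂ q = inj₂ q
  FCV-sub σ (nrec r s t) (fcv-nrec1 p) with FCV-sub σ r p
  ... | inj₁ q = inj₁ (fcv-nrec1 q)
  ... | inj₂ q = inj₂ q
  FCV-sub σ (nrec r s t) (fcv-nrec2 p) with FCV-sub σ s p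
  ... | inj₁ q = inj₁ (fcv-nrec2 q)
  ... | inj₂ q = inj₂ q
  FCV-sub σ (nrec r s t) (fcv-nrec3 p) with FCV-sub σ t p
  ... | inj₁ q = inj₁ (fcv-nrec3 q)
  ... | inj₂ q = inj₂ q

  FCV-subc : ∀ {α} σ c → α ∈FCVc subc σ c → α ∈FCVc c ⊎ Σ ℕ (λ n → α ∈FCV σ n)
  FCV-subc σ (⟨ β ⟩ t) fcv-head = inj₁ fcv-head
  FCV-subc σ (⟨ β ⟩ t) (fcv-body p) with FCV-sub σ t p
  ... | inj₁ q = inj₁ (fcv-body q)
  ... | inj₂ q = inj₂ q

-- The free μ-variables of the context E are those of E[0].
FCV-plug : ∀ {α} E q → α ∈FCV plug E q → α ∈FCV plug E Z ⊎ α ∈FCV q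
FCV-plug □ q p = inj₂ p
FCV-plug (appE E t) q (fcv-appl p) with FCV-plug E q p
... | inj₁ r = inj₁ (fcv-appl r)
... | inj₂ r = inj₂ r
FCV-plug (appE E t) q (fcv-appr p) = inj₁ (fcv-appr p)
FCV-plug (sucE E) q (fcv-S p) with FCV-plug E q p
... | inj₁ r = inj₁ (fcv-S r)
... | inj₂ r = inj₂ r
FCV-plug (nrecE r s E) q (fcv-nrec1 p) = inj₁ (fcv-nrec1 p)
FCV-plug (nrecE r s E) q (fcv-nrec2 p) = inj₁ (fcv-nrec2 p)
FCV-plug (nrecE r s E) q (fcv-nrec3 p) with FCV-plug E q p
... | inj₁ r' = inj₁ (fcv-nrec3 r')
... | inj₂ r' = inj₂ r'

_∈FCVe_ : ℕ → ℕ × Ctx → Set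
α ∈FCVe e = proj₁ e ≡ α ⊎ α ∈FCV plug (proj₂ e) Z

FCV-plug-renμ : ∀ {α} ρ E → α ∈FCV plug (renμE ρ E) Z → Σ ℕ λ β → β ∈FCV plug E Z × ρ β ≡ α
FCV-plug-renμ ρ E p = FCV-renμ (plug E Z) (subst (_ ∈FCV_) (sym (renμ-plug ρ E Z)) p)

mutual
  FCV-ssub : ∀ {α} σ t → α ∈FCV ssub σ t → Σ ℕ λ j → j ∈FCV t × α ∈FCVe σ j
  FCV-ssub σ (var n) ()
  FCV-ssub σ (lam t) (fcv-lam p) with FCV-ssub (liftλ σ) t p
  ... | j , q , inj₁ e = j , fcv-lam q , inj₁ e
  ... | j , q , inj₂ r = j , fcv-lam q , inj₂ (FCV-renλ (plug (proj₂ (σ j)) Z)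
                              (subst (_ ∈FCV_) (sym (renλ-plug suc (proj₂ (σ j)) Z)) r))
  FCV-ssub σ (t · s) (fcv-appl p) with FCV-ssub σ t p
  ... | j , q , x = j , fcv-appl q , x
  FCV-ssub σ (t · s) (fcv-appr p) with FCV-ssub σ s p
  ... | j , q , x = j , fcv-appr q , x
  FCV-ssub σ (mu c) (fcv-mu p) with FCV-ssubc (liftμ σ) c p
  ... | zero , q , inj₁ ()
  ... | zero , q , inj₂ ()
  ... | suc j , q , inj₁ e = j , fcv-mu q , inj₁ (suc-injective e)
  ... | suc j , q , inj₂ r with FCV-plug-renμ suc (proj₂ (σ j)) r
  ... | β , r' , e = j , fcv-mu q , inj₂ (subst (_∈FCV plug (proj₂ (σ j)) Z) (suc-injective e) r')
  FCV-ssub σ Z ()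
  FCV-ssub σ (S t) (fcv-S p) with FCV-ssub σ t p
  ... | j , q , x = j , fcv-S q , x
  FCV-ssub σ (nrec r s t) (fcv-nrec1 p) with FCV-ssub σ r p
  ... | j , q , x = j , fcv-nrec1 q , x
  FCV-ssub σ (nrec r s t) (fcv-nrec2 p) with FCV-ssub σ s p
  ... | j , q , x = j , fcv-nrec2 q , x
  FCV-ssub σ (nrec r s t) (fcv-nrec3 p) with FCV-ssub σ t p
  ... | j , q , x = j , fcv-nrec3 q , x

  FCV-ssubc : ∀ {α} σ c → α ∈FCVc ssubc σ c → Σ ℕ λ j → j ∈FCVc c × α ∈FCVe σ j
  FCV-ssubc σ (⟨ β ⟩ q) fcv-head = β , fcv-head , inj₁ refl
  FCV-ssubc σ (⟨ β ⟩ q) (fcv-body p) with FCV-plug (proj₂ (σ β)) (ssub σ q) p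
  ... | inj₁ r = β , fcv-head , inj₂ r
  ... | inj₂ r with FCV-ssub σ q r
  ... | j , r' , x = j , fcv-body r' , x

num-noFCV : ∀ {α} n → ¬ α ∈FCV num n
num-noFCV zero ()
num-noFCV (suc n) (fcv-S p) = num-noFCV n p

FCV-keepE : ∀ {α} E c → α ∈FCV mu (ssubc (keepE E) c) → α ∈FCV mu c ⊎ α ∈FCV plug E Z
FCV-keepE E c (fcv-mu p) with FCV-ssubc (keepE E) c p
... | zero , q , inj₁ ()
... | zero , q , inj₂ r with FCV-plug-renμ suc E r
...   | β , r' , e = inj₂ (subst (_∈FCV plug E Z) (suc-injective e) r')
FCV-keepE E c (fcv-mu p) | suc j , q , inj₁ e = inj₁ (fcv-mu (subst (_∈FCVc c) e q))
FCV-keepE E c (fcv-mu p) | suc j , q , inj₂ ()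

mutual
  A-FCV : ∀ {α t t'} → t →A t' → α ∈FCV t' → α ∈FCV t
  A-FCV {t = lam t · r} β-rule p with FCV-sub (sub0 r) t p
  ... | inj₁ q = fcv-appl (fcv-lam q)
  ... | inj₂ (zero , q) = fcv-appr q
  ... | inj₂ (suc n , ())
  A-FCV {t = S (mu c)} μS p with FCV-keepE (sucE □) c p
  ... | inj₁ q = fcv-S q
  ... | inj₂ (fcv-S ())
  A-FCV {t = mu c · s} μapp p with FCV-keepE (appE □ s) c p
  ... | inj₁ q = fcv-appl q
  ... | inj₂ (fcv-appl ())
  ... | inj₂ (fcv-appr q) = fcv-appr q
  A-FCV nrec-0 p = fcv-nrec1 p
  A-FCV (nrec-S n) (fcv-appl (fcv-appl p)) = fcv-nrec2 p
  A-FCV (nrec-S n) (fcv-appl (fcv-appr p)) = ⊥-elim (num-noFCV n p)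
  A-FCV (nrec-S n) (fcv-appr (fcv-nrec1 p)) = fcv-nrec1 p
  A-FCV (nrec-S n) (fcv-appr (fcv-nrec2 p)) = fcv-nrec2 p
  A-FCV (nrec-S n) (fcv-appr (fcv-nrec3 p)) = ⊥-elim (num-noFCV n p)
  A-FCV {t = nrec r s (mu c)} nrec-μ p with FCV-keepE (nrecE r s □) c p
  ... | inj₁ q = fcv-nrec3 q
  ... | inj₂ (fcv-nrec1 q) = fcv-nrec1 q
  ... | inj₂ (fcv-nrec2 q) = fcv-nrec2 q
  ... | inj₂ (fcv-nrec3 ())
  A-FCV (c-lam a) (fcv-lam p) = fcv-lam (A-FCV a p)
  A-FCV (c-appl a) (fcv-appl p) = fcv-appl (A-FCV a p)
  A-FCV (c-appl a) (fcv-appr p) = fcv-appr p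
  A-FCV (c-appr a) (fcv-appl p) = fcv-appl p
  A-FCV (c-appr a) (fcv-appr p) = fcv-appr (A-FCV a p)
  A-FCV (c-mu a) (fcv-mu p) = fcv-mu (A-FCVc a p)
  A-FCV (c-S a) (fcv-S p) = fcv-S (A-FCV a p)
  A-FCV (c-nrec1 a) (fcv-nrec1 p) = fcv-nrec1 (A-FCV a p)
  A-FCV (c-nrec1 a) (fcv-nrec2 p) = fcv-nrec2 p
  A-FCV (c-nrec1 a) (fcv-nrec3 p) = fcv-nrec3 p
  A-FCV (c-nrec2 a) (fcv-nrec1 p) = fcv-nrec1 p
  A-FCV (c-nrec2 a) (fcv-nrec2 p) = fcv-nrec2 (A-FCV a p)
  A-FCV (c-nrec2 a) (fcv-nrec3 p) = fcv-nrec3 p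
  A-FCV (c-nrec3 a) (fcv-nrec1 p) = fcv-nrec1 p
  A-FCV (c-nrec3 a) (fcv-nrec2 p) = fcv-nrec2 p
  A-FCV (c-nrec3 a) (fcv-nrec3 p) = fcv-nrec3 (A-FCV a p)

  A-FCVc : ∀ {α c c'} → c →Ac c' → α ∈FCVc c' → α ∈FCVc c
  A-FCVc (c-cmd a) fcv-head = fcv-head
  A-FCVc (c-cmd a) (fcv-body p) = fcv-body (A-FCV a p)

_↠B_ : Term → Term → Set
_↠B_ = Star _→B_

_↠Bc_ : Cmd → Cmd → Set
_↠Bc_ = Star _→Bc_

data _→ABc_ (c c' : Cmd) : Set where
  cA : c →Ac c' → c →ABc c'
  cB : c →Bc c' → c →ABc c'

_↠ABc_ : Cmd → Cmd → Set
_↠ABc_ = Star _→ABc_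

↠AB-cong : ∀ (f : Term → Term) → (∀ {x y} → x →A y → f x →A f y) → (∀ {x y} → x →B y → f x →B f y) →
           ∀ {x y} → x ↠AB y → f x ↠AB f y
↠AB-cong f fa fb = gmap f (λ { (stepA a) → stepA (fa a) ; (stepB b) → stepB (fb b) })

↠AB-mu : ∀ {c c'} → c ↠ABc c' → mu c ↠AB mu c'
↠AB-mu = gmap mu (λ { (cA a) → stepA (c-mu a) ; (cB b) → stepB (c-mu b) })

↠AB-cmd : ∀ α {t t'} → t ↠AB t' → (⟨ α ⟩ t) ↠ABc (⟨ α ⟩ t')
↠AB-cmd α = gmap (⟨ α ⟩_) (λ { (stepA a) → cA (c-cmd a) ; (stepB b) → cB (c-cmd b) })

↠B⇒↠AB : ∀ {t t'} → t ↠B t' → t ↠AB t'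
↠B⇒↠AB = gmap (λ t → t) stepB

plug-A : ∀ E {t t'} → t →A t' → plug E t →A plug E t'
plug-A □ a = a
plug-A (appE E s) a = c-appl (plug-A E a)
plug-A (sucE E) a = c-S (plug-A E a)
plug-A (nrecE r s E) a = c-nrec3 (plug-A E a)

plug-B : ∀ E {t t'} → t →B t' → plug E t →B plug E t'
plug-B □ b = b
plug-B (appE E s) b = c-appl (plug-B E b)
plug-B (sucE E) b = c-S (plug-B E b)
plug-B (nrecE r s E) b = c-nrec3 (plug-B E b)

contract : ℕ → ℕ → ℕ
contract α zero = α
contract α (suc j) = j

renameTo-renaming : ∀ α j → renameTo α j ≡ (contract α j , □)
renameTo-renaming α zero = refl
renameTo-renaming α (suc j) = refl

mutual
  renμ-B : ∀ ρ {t t'} → t →B t' → renμ ρ t →B renμ ρ t'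
  renμ-B ρ (μη {t} nf) = subst (mu (⟨ 0 ⟩ renμ (ext ρ) t) →B_) eq (μη nf')
    where
      eq : renμ pred (renμ (ext ρ) t) ≡ renμ ρ (renμ pred t)
      eq = trans (renμ-renμ {ρ'' = λ j → pred (ext ρ j)} (λ j → refl) t)
             (trans (renμ-cong-FCV t (λ { zero p → ⊥-elim (nf p) ; (suc j) p → refl }))
                    (sym (renμ-renμ (λ j → refl) t)))
      nf' : ¬ (0 ∈FCV renμ (ext ρ) t)
      nf' p with FCV-renμ t p
      ... | zero , q , _ = nf q
      ... | suc _ , _ , ()
  renμ-B ρ (c-lam b) = c-lam (renμ-B ρ b)
  renμ-B ρ (c-appl b) = c-appl (renμ-B ρ b)
  renμ-B ρ (c-appr b) = c-appr (renμ-B ρ b)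
  renμ-B ρ (c-mu b) = c-mu (renμc-B (ext ρ) b)
  renμ-B ρ (c-S b) = c-S (renμ-B ρ b)
  renμ-B ρ (c-nrec1 b) = c-nrec1 (renμ-B ρ b)
  renμ-B ρ (c-nrec2 b) = c-nrec2 (renμ-B ρ b)
  renμ-B ρ (c-nrec3 b) = c-nrec3 (renμ-B ρ b)

  renμc-B : ∀ ρ {c c'} → c →Bc c' → renμc ρ c →Bc renμc ρ c'
  renμc-B ρ (μμ {α} {c}) = subst (⟨ ρ α ⟩ mu (renμc (ext ρ) c) →Bc_) eq μμ
    where
      eq : ssubc (renameTo (ρ α)) (renμc (ext ρ) c) ≡ renμc ρ (ssubc (renameTo α) c)
      eq = trans (ssubc-renμc (λ j → refl) c)
             (trans (ssubc-cong (λ { zero → refl ; (suc j) → refl }) c) (sym (renμc-ssubc (λ j → refl) c)))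
  renμc-B ρ (c-cmd b) = c-cmd (renμ-B ρ b)

mutual
  renλ-B : ∀ ρ {t t'} → t →B t' → renλ ρ t →B renλ ρ t'
  renλ-B ρ (μη {t} nf) = subst (mu (⟨ 0 ⟩ renλ ρ t) →B_) (sym (renλ-renμ ρ pred t)) (μη (λ p → nf (FCV-renλ t p)))
  renλ-B ρ (c-lam b) = c-lam (renλ-B (ext ρ) b)
  renλ-B ρ (c-appl b) = c-appl (renλ-B ρ b)
  renλ-B ρ (c-appr b) = c-appr (renλ-B ρ b)
  renλ-B ρ (c-mu b) = c-mu (renλc-B ρ b)
  renλ-B ρ (c-S b) = c-S (renλ-B ρ b)
  renλ-B ρ (c-nrec1 b) = c-nrec1 (renλ-B ρ b)
  renλ-B ρ (c-nrec2 b) = c-nrec2 (renλ-B ρ b)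
  renλ-B ρ (c-nrec3 b) = c-nrec3 (renλ-B ρ b)

  renλc-B : ∀ ρ {c c'} → c →Bc c' → renλc ρ c →Bc renλc ρ c'
  renλc-B ρ (μμ {α} {c}) = subst (⟨ α ⟩ mu (renλc ρ c) →Bc_)
     (ssubc-renλc {ρ} {renameTo α} {renameTo α} (λ { zero → refl ; (suc j) → refl }) c) μμ
  renλc-B ρ (c-cmd b) = c-cmd (renλ-B ρ b)

mutual
  sub-B : ∀ σ {t t'} → t →B t' → sub σ t →B sub σ t'
  sub-B σ (μη {t} nf) = subst (mu (⟨ 0 ⟩ sub σ' t) →B_) (renμ-sub (λ n → renμ-pred-suc (σ n)) t) (μη nf')
    where
      σ' : ℕ → Term
      σ' n = renμ suc (σ n)
      nf' : ¬ (0 ∈FCV sub σ' t)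
      nf' p with FCV-sub σ' t p
      ... | inj₁ q = nf q
      ... | inj₂ (n , q) = zero∉FCV-shift (σ n) q
  sub-B σ (c-lam b) = c-lam (sub-B (exts σ) b)
  sub-B σ (c-appl b) = c-appl (sub-B σ b)
  sub-B σ (c-appr b) = c-appr (sub-B σ b)
  sub-B σ (c-mu b) = c-mu (subc-B (λ n → renμ suc (σ n)) b)
  sub-B σ (c-S b) = c-S (sub-B σ b)
  sub-B σ (c-nrec1 b) = c-nrec1 (sub-B σ b)
  sub-B σ (c-nrec2 b) = c-nrec2 (sub-B σ b)
  sub-B σ (c-nrec3 b) = c-nrec3 (sub-B σ b)

  subc-B : ∀ σ {c c'} → c →Bc c' → subc σ c →Bc subc σ c'
  subc-B σ (μμ {α} {c}) = subst (⟨ α ⟩ mu (subc σ' c) →Bc_) eq μμ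
    where
      σ' : ℕ → Term
      σ' n = renμ suc (σ n)
      eq : ssubc (renameTo α) (subc σ' c) ≡ subc σ (ssubc (renameTo α) c)
      eq = trans (ssubc-renaming (renameTo-renaming α) (subc σ' c))
             (trans (renμc-subc (λ n → renμ-unshift (λ _ → refl) (σ n)) c)
                    (cong (subc σ) (sym (ssubc-renaming (renameTo-renaming α) c))))
  subc-B σ (c-cmd b) = c-cmd (sub-B σ b)

mutual
  sub-↠B : ∀ {σ σ'} → (∀ n → σ n ↠B σ' n) → ∀ t → sub σ t ↠B sub σ' t
  sub-↠B h (var n) = h n
  sub-↠B {σ} {σ'} h (lam t) = gmap lam c-lam (sub-↠B lifted t)
    where lifted : ∀ n → exts σ n ↠B exts σ' n
          lifted zero = ε
          lifted (suc n) = gmap (renλ suc) (renλ-B suc) (h n)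
  sub-↠B {σ} {σ'} h (t · s) = gmap (_· sub σ s) c-appl (sub-↠B h t) ◅◅ gmap (sub σ' t ·_) c-appr (sub-↠B h s)
  sub-↠B h (mu c) = gmap mu c-mu (subc-↠B (λ n → gmap (renμ suc) (renμ-B suc) (h n)) c)
  sub-↠B h Z = ε
  sub-↠B h (S t) = gmap S c-S (sub-↠B h t)
  sub-↠B {σ} {σ'} h (nrec r s t) =
    gmap (λ x → nrec x (sub σ s) (sub σ t)) c-nrec1 (sub-↠B h r) ◅◅
    gmap (λ x → nrec (sub σ' r) x (sub σ t)) c-nrec2 (sub-↠B h s) ◅◅
    gmap (nrec (sub σ' r) (sub σ' s)) c-nrec3 (sub-↠B h t)

  subc-↠B : ∀ {σ σ'} → (∀ n → σ n ↠B σ' n) → ∀ c → subc σ c ↠Bc subc σ' c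
  subc-↠B h (⟨ α ⟩ t) = gmap (⟨ α ⟩_) c-cmd (sub-↠B h t)

data _↠BE_ : Ctx → Ctx → Set where
  □ : □ ↠BE □
  appE : ∀ {E E' t t'} → E ↠BE E' → t ↠B t' → appE E t ↠BE appE E' t'
  sucE : ∀ {E E'} → E ↠BE E' → sucE E ↠BE sucE E'
  nrecE : ∀ {r r' s s' E E'} → r ↠B r' → s ↠B s' → E ↠BE E' → nrecE r s E ↠BE nrecE r' s' E'

renμE-↠B : ∀ ρ {E E'} → E ↠BE E' → renμE ρ E ↠BE renμE ρ E'
renμE-↠B ρ □ = □
renμE-↠B ρ (appE e b) = appE (renμE-↠B ρ e) (gmap (renμ ρ) (renμ-B ρ) b)
renμE-↠B ρ (sucE e) = sucE (renμE-↠B ρ e)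
renμE-↠B ρ (nrecE b b' e) = nrecE (gmap (renμ ρ) (renμ-B ρ) b) (gmap (renμ ρ) (renμ-B ρ) b') (renμE-↠B ρ e)

renλE-↠B : ∀ ρ {E E'} → E ↠BE E' → renλE ρ E ↠BE renλE ρ E'
renλE-↠B ρ □ = □
renλE-↠B ρ (appE e b) = appE (renλE-↠B ρ e) (gmap (renλ ρ) (renλ-B ρ) b)
renλE-↠B ρ (sucE e) = sucE (renλE-↠B ρ e)
renλE-↠B ρ (nrecE b b' e) = nrecE (gmap (renλ ρ) (renλ-B ρ) b) (gmap (renλ ρ) (renλ-B ρ) b') (renλE-↠B ρ e)

plug-↠B : ∀ {E E' q q'} → E ↠BE E' → q ↠B q' → plug E q ↠B plug E' q'
plug-↠B □ bq = bq
plug-↠B {appE E t} {appE E' t'} {q} {q'} (appE e b) bq =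
  gmap (_· t) c-appl (plug-↠B e bq) ◅◅ gmap (plug E' q' ·_) c-appr b
plug-↠B (sucE e) bq = gmap S c-S (plug-↠B e bq)
plug-↠B {nrecE r s E} {nrecE r' s' E'} {q} {q'} (nrecE b b' e) bq =
  gmap (λ x → nrec x s (plug E q)) c-nrec1 b ◅◅
  gmap (λ x → nrec r' x (plug E q)) c-nrec2 b' ◅◅
  gmap (nrec r' s') c-nrec3 (plug-↠B e bq)

mutual
  ssub-↠B : ∀ {σ σ'} → (∀ j → proj₁ (σ j) ≡ proj₁ (σ' j)) → (∀ j → proj₂ (σ j) ↠BE proj₂ (σ' j)) →
            ∀ t → ssub σ t ↠B ssub σ' t
  ssub-↠B h k (var n) = ε
  ssub-↠B h k (lam t) = gmap lam c-lam (ssub-↠B h (λ j → renλE-↠B suc (k j)) t)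
  ssub-↠B {σ} {σ'} h k (t · s) = gmap (_· ssub σ s) c-appl (ssub-↠B h k t) ◅◅ gmap (ssub σ' t ·_) c-appr (ssub-↠B h k s)
  ssub-↠B h k (mu c) = gmap mu c-mu (ssubc-↠B (λ { zero → refl ; (suc j) → cong suc (h j) })
                                              (λ { zero → □ ; (suc j) → renμE-↠B suc (k j) }) c)
  ssub-↠B h k Z = ε
  ssub-↠B h k (S t) = gmap S c-S (ssub-↠B h k t)
  ssub-↠B {σ} {σ'} h k (nrec r s t) =
    gmap (λ x → nrec x (ssub σ s) (ssub σ t)) c-nrec1 (ssub-↠B h k r) ◅◅
    gmap (λ x → nrec (ssub σ' r) x (ssub σ t)) c-nrec2 (ssub-↠B h k s) ◅◅
    gmap (nrec (ssub σ' r) (ssub σ' s)) c-nrec3 (ssub-↠B h k t)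

  ssubc-↠B : ∀ {σ σ'} → (∀ j → proj₁ (σ j) ≡ proj₁ (σ' j)) → (∀ j → proj₂ (σ j) ↠BE proj₂ (σ' j)) →
             ∀ c → ssubc σ c ↠Bc ssubc σ' c
  ssubc-↠B {σ} {σ'} h k (⟨ α ⟩ q) =
    subst (λ β → (⟨ proj₁ (σ α) ⟩ plug (proj₂ (σ α)) (ssub σ q)) ↠Bc (⟨ β ⟩ plug (proj₂ (σ' α)) (ssub σ' q)))
      (h α) (gmap (⟨ proj₁ (σ α) ⟩_) c-cmd (plug-↠B (k α) (ssub-↠B h k q)))

-- Hence μα.c[α := α E] ↠B μα.c[α := α E'] whenever E ↠BE E'; this
-- resolves every A-redex μα.c placed in a B-reducing frame.
keepE-↠B : ∀ {E E'} → E ↠BE E' → ∀ c → mu (ssubc (keepE E) c) ↠B mu (ssubc (keepE E') c)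
keepE-↠B e c = gmap mu c-mu (ssubc-↠B (λ { zero → refl ; (suc j) → refl })
                                       (λ { zero → renμE-↠B suc e ; (suc j) → □ }) c)

-- Laws of the two special structural substitutions keepE and renameTo.
-- Shifted material contains no μ-index 0, so keepE leaves it alone and
-- renameTo undoes the shift.
keepE-shift : ∀ E t → ssub (keepE E) (renμ suc t) ≡ renμ suc t
keepE-shift E t = trans (ssub-renμ {θ = λ j → (suc j , □)} (λ j → refl) t) (ssub-renaming (λ j → refl) t)

keepE-shiftE : ∀ E F → ssubE (keepE E) (renμE suc F) ≡ renμE suc F
keepE-shiftE E F = trans (cong (ssubE (keepE E)) (renμE-map suc F))
  (trans (mapE-square {k = λ x → x} (keepE-shift E) F)
         (trans (cong (mapE (renμ suc)) (mapE-id (λ x → refl) F)) (sym (renμE-map suc F))))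

renameTo-shift : ∀ β t → ssub (renameTo β) (renμ suc t) ≡ t
renameTo-shift β t = trans (ssub-renμ {θ = λ j → (j , □)} (λ j → refl) t) (ssub-id (λ j → refl) t)

renameTo-shiftE : ∀ β E → ssubE (renameTo β) (renμE suc E) ≡ E
renameTo-shiftE β E = trans (cong (ssubE (renameTo β)) (renμE-map suc E))
  (trans (mapE-fuse (renameTo-shift β) E) (mapE-id (λ x → refl) E))

keepE-□ : ∀ j → keepE □ j ≡ (j , □)
keepE-□ zero = refl
keepE-□ (suc j) = refl

keepE-keepE : ∀ F E c → ssubc (keepE F) (ssubc (keepE E) c) ≡ ssubc (keepE (F ⊚ E)) c
keepE-keepE F E c = trans (ssubc-ssubc (λ j → refl) c) (ssubc-cong composed c)
  where composed : ∀ j → (keepE F ⊙ keepE E) j ≡ keepE (F ⊚ E) j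
        composed zero = cong (0 ,_) (trans (cong (renμE suc F ⊚_) (keepE-shiftE F E)) (sym (renμE-⊚ suc F E)))
        composed (suc j) = refl

-- Structural substitution commutes with μμ-contraction, up to the
-- context E of the entry of α:  ([α]μβ.d)σ  contracts, after pushing
-- E[μβ.dσ] into μβ, to  (d[β := α□])σ.
ssubc-μμ : ∀ σ α d → ssubc (renameTo (proj₁ (σ α))) (ssubc (keepE (proj₂ (σ α))) (ssubc (liftμ σ) d))
                     ≡ ssubc σ (ssubc (renameTo α) d)
ssubc-μμ σ α d = trans (cong (ssubc (renameTo β)) (ssubc-ssubc (λ j → refl) d))
  (trans (ssubc-ssubc (λ j → refl) d) (trans (ssubc-cong agree d) (sym (ssubc-ssubc (λ j → refl) d))))
  where
    β = proj₁ (σ α)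
    E = proj₂ (σ α)
    agree : ∀ j → (renameTo β ⊙ (keepE E ⊙ liftμ σ)) j ≡ (σ ⊙ renameTo α) j
    agree zero = cong (β ,_) (trans (cong (ssubE (renameTo β)) (⊚-□ (renμE suc E)))
                               (trans (renameTo-shiftE β E) (sym (⊚-□ E))))
    agree (suc k) = cong (proj₁ (σ k) ,_)
                      (trans (cong (ssubE (renameTo β)) (keepE-shiftE E (proj₂ (σ k))))
                        (trans (renameTo-shiftE _ (proj₂ (σ k))) (sym (⊚-□ (proj₂ (σ k))))))

_↠A_ : Term → Term → Set
_↠A_ = Star _→A_

plug-mu-↠A : ∀ E d → plug E (mu d) ↠A mu (ssubc (keepE E) d)
plug-mu-↠A □ d = subst (λ c → mu d ↠A mu c) (sym (ssubc-id keepE-□ d)) ε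
plug-mu-↠A (appE E t) d = gmap (_· t) c-appl (plug-mu-↠A E d) ◅◅
  (subst (λ c → mu (ssubc (keepE E) d) · t →A mu c) (keepE-keepE (appE □ t) E d) μapp ◅ ε)
plug-mu-↠A (sucE E) d = gmap S c-S (plug-mu-↠A E d) ◅◅
  (subst (λ c → S (mu (ssubc (keepE E) d)) →A mu c) (keepE-keepE (sucE □) E d) μS ◅ ε)
plug-mu-↠A (nrecE r s E) d = gmap (nrec r s) c-nrec3 (plug-mu-↠A E d) ◅◅
  (subst (λ c → nrec r s (mu (ssubc (keepE E) d)) →A mu c) (keepE-keepE (nrecE r s □) E d) nrec-μ ◅ ε)

-- A structural substitution maps a B-step to an AB-reduction.  Only
-- μμ needs A-steps: the context E placed before μβ.d must first be
-- pushed inside it by plug-mu-↠A.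
mutual
  ssub-B : ∀ σ {t t'} → t →B t' → ssub σ t ↠AB ssub σ t'
  ssub-B σ (μη {t} nf) = stepB (subst (mu (⟨ 0 ⟩ ssub (liftμ σ) t) →B_) eq (μη nf')) ◅ ε
    where
      unshifted : SSub
      unshifted j = pred (proj₁ (liftμ σ j)) , renμE pred (proj₂ (liftμ σ j))
      eq : renμ pred (ssub (liftμ σ) t) ≡ ssub σ (renμ pred t)
      eq = trans (renμ-ssub {θ = unshifted} (λ j → refl) t)
             (trans (ssub-cong-FCV t (λ { zero p → ⊥-elim (nf p)
                                        ; (suc k) p → cong (proj₁ (σ k) ,_) (renμE-pred-suc (proj₂ (σ k))) }))
                    (sym (ssub-renμ (λ j → refl) t)))
      nf' : ¬ (0 ∈FCV ssub (liftμ σ) t)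
      nf' p with FCV-ssub (liftμ σ) t p
      ... | zero , q , _ = nf q
      ... | suc j , q , inj₁ ()
      ... | suc j , q , inj₂ r with FCV-plug-renμ suc (proj₂ (σ j)) r
      ... | _ , _ , ()
  ssub-B σ (c-lam b) = ↠AB-cong lam c-lam c-lam (ssub-B (liftλ σ) b)
  ssub-B σ (c-appl {s = s} b) = ↠AB-cong (_· ssub σ s) c-appl c-appl (ssub-B σ b)
  ssub-B σ (c-appr {t = t} b) = ↠AB-cong (ssub σ t ·_) c-appr c-appr (ssub-B σ b)
  ssub-B σ (c-mu b) = ↠AB-mu (ssubc-B (liftμ σ) b)
  ssub-B σ (c-S b) = ↠AB-cong S c-S c-S (ssub-B σ b)
  ssub-B σ (c-nrec1 {s = s} {t = t} b) = ↠AB-cong (λ x → nrec x (ssub σ s) (ssub σ t)) c-nrec1 c-nrec1 (ssub-B σ b)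
  ssub-B σ (c-nrec2 {r = r} {t = t} b) = ↠AB-cong (λ x → nrec (ssub σ r) x (ssub σ t)) c-nrec2 c-nrec2 (ssub-B σ b)
  ssub-B σ (c-nrec3 {r = r} {s = s} b) = ↠AB-cong (nrec (ssub σ r) (ssub σ s)) c-nrec3 c-nrec3 (ssub-B σ b)

  ssubc-B : ∀ σ {c c'} → c →Bc c' → ssubc σ c ↠ABc ssubc σ c'
  ssubc-B σ (μμ {α} {d}) =
    subst (ssubc σ (⟨ α ⟩ mu d) ↠ABc_) (ssubc-μμ σ α d)
      (gmap (⟨ proj₁ (σ α) ⟩_) (λ a → cA (c-cmd a)) (plug-mu-↠A (proj₂ (σ α)) (ssubc (liftμ σ) d)) ◅◅ (cB μμ ◅ ε))
  ssubc-B σ (c-cmd {α} b) =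
    ↠AB-cmd (proj₁ (σ α)) (↠AB-cong (plug (proj₂ (σ α))) (plug-A (proj₂ (σ α))) (plug-B (proj₂ (σ α))) (ssub-B σ b))

renμ-num : ∀ ρ n → renμ ρ (num n) ≡ num n
renμ-num ρ zero = refl
renμ-num ρ (suc n) = cong S (renμ-num ρ n)

ssub-num : ∀ σ n → ssub σ (num n) ≡ num n
ssub-num σ zero = refl
ssub-num σ (suc n) = cong S (ssub-num σ n)

data NumeralHead : Term → Set where
  zero-head : NumeralHead Z
  suc-head  : ∀ {t} → NumeralHead (S t)

numeral-head : ∀ {t} n → t ≡ num n → NumeralHead t
numeral-head zero refl = zero-head
numeral-head (suc n) refl = suc-head

renμ-num-inv : ∀ {ρ} u n → renμ ρ u ≡ num n → u ≡ num n
renμ-num-inv Z zero e = refl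
renμ-num-inv (S u) (suc n) e = cong S (renμ-num-inv u n (cong unS e))
  where unS : Term → Term
        unS (S t) = t
        unS t = t
renμ-num-inv (var _) n e with () ← numeral-head n e
renμ-num-inv (lam _) n e with () ← numeral-head n e
renμ-num-inv (_ · _) n e with () ← numeral-head n e
renμ-num-inv (mu _) n e with () ← numeral-head n e
renμ-num-inv (nrec _ _ _) n e with () ← numeral-head n e
renμ-num-inv Z (suc n) ()
renμ-num-inv (S u) zero ()

renμ-keepE : ∀ ρ E c → renμ ρ (mu (ssubc (keepE E) c)) ≡ mu (ssubc (keepE (renμE ρ E)) (renμc (ext ρ) c))
renμ-keepE ρ E c = cong mu (trans (renμc-ssubc (λ j → refl) c) (trans (ssubc-cong agree c) (sym (ssubc-renμc (λ j → refl) c))))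
  where agree : ∀ j → (ext ρ (proj₁ (keepE E j)) , renμE (ext ρ) (proj₂ (keepE E j))) ≡ keepE (renμE ρ E) (ext ρ j)
        agree zero = cong (0 ,_) (trans (renμE-renμE (λ j → refl) E) (sym (renμE-renμE (λ j → refl) E)))
        agree (suc j) = refl

-- Reflection of A-steps along a μ-renaming ρ: an A-step out of renμ ρ t
-- is the image of an A-step out of t.  (A-redexes are determined by
-- term shapes, which renaming does not change.)
ReflectsA : (ℕ → ℕ) → Term → Term → Set
ReflectsA ρ t u = Σ Term λ t' → (t →A t') × (renμ ρ t' ≡ u)

mutual
  reflect-A : ∀ ρ t {u} → renμ ρ t →A u → ReflectsA ρ t u
  reflect-A ρ (var n) ()
  reflect-A ρ (lam t) (c-lam a) with reflect-A ρ t a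
  ... | t' , a' , e = lam t' , c-lam a' , cong lam e
  reflect-A ρ (lam t · s) β-rule = sub (sub0 s) t , β-rule , renμ-sub (λ { zero → refl ; (suc n) → refl }) t
  reflect-A ρ (mu c · s) μapp = mu (ssubc (keepE (appE □ s)) c) , μapp , renμ-keepE ρ (appE □ s) c
  reflect-A ρ (t · s) (c-appl a) with reflect-A ρ t a
  ... | t' , a' , e = t' · s , c-appl a' , cong (_· renμ ρ s) e
  reflect-A ρ (t · s) (c-appr a) with reflect-A ρ s a
  ... | s' , a' , e = t · s' , c-appr a' , cong (renμ ρ t ·_) e
  reflect-A ρ (mu c) (c-mu a) with reflectᶜ-A (ext ρ) c a
  ... | c' , a' , e = mu c' , c-mu a' , cong mu e
  reflect-A ρ Z ()
  reflect-A ρ (S (mu c)) μS = mu (ssubc (keepE (sucE □)) c) , μS , renμ-keepE ρ (sucE □) c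
  reflect-A ρ (S t) (c-S a) with reflect-A ρ t a
  ... | t' , a' , e = S t' , c-S a' , cong S e
  reflect-A ρ (nrec r s (S t)) a = reflect-A-nrecS ρ r s t refl a
  reflect-A ρ (nrec r s Z) nrec-0 = r , nrec-0 , refl
  reflect-A ρ (nrec r s (mu c)) nrec-μ = mu (ssubc (keepE (nrecE r s □)) c) , nrec-μ , renμ-keepE ρ (nrecE r s □) c
  reflect-A ρ (nrec r s t) (c-nrec1 a) with reflect-A ρ r a
  ... | r' , a' , e = nrec r' s t , c-nrec1 a' , cong-nrec e refl refl
  reflect-A ρ (nrec r s t) (c-nrec2 a) with reflect-A ρ s a
  ... | s' , a' , e = nrec r s' t , c-nrec2 a' , cong-nrec refl e refl
  reflect-A ρ (nrec r s t) (c-nrec3 a) with reflect-A ρ t a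
  ... | t' , a' , e = nrec r s t' , c-nrec3 a' , cong-nrec refl refl e

  -- The case nrec r s (S t), with renμ ρ t generalised to v so that the
  -- rule nrec-S (whose argument must be a numeral) can be matched.
  reflect-A-nrecS : ∀ ρ r s t {v u} → renμ ρ t ≡ v → nrec (renμ ρ r) (renμ ρ s) (S v) →A u →
                    ReflectsA ρ (nrec r s (S t)) u
  reflect-A-nrecS ρ r s t e (nrec-S n) with renμ-num-inv t n e
  ... | refl = (s · num n) · nrec r s (num n) , nrec-S n ,
               cong₂ (λ m k → (renμ ρ s · m) · nrec (renμ ρ r) (renμ ρ s) k) (renμ-num ρ n) (renμ-num ρ n)
  reflect-A-nrecS ρ r s (mu c) refl (c-nrec3 μS) =
    nrec r s (mu (ssubc (keepE (sucE □)) c)) , c-nrec3 μS , cong (nrec (renμ ρ r) (renμ ρ s)) (renμ-keepE ρ (sucE □) c)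
  reflect-A-nrecS ρ r s t refl (c-nrec1 a) with reflect-A ρ r a
  ... | r' , a' , e' = nrec r' s (S t) , c-nrec1 a' , cong-nrec e' refl refl
  reflect-A-nrecS ρ r s t refl (c-nrec2 a) with reflect-A ρ s a
  ... | s' , a' , e' = nrec r s' (S t) , c-nrec2 a' , cong-nrec refl e' refl
  reflect-A-nrecS ρ r s t refl (c-nrec3 (c-S a)) with reflect-A ρ t a
  ... | t' , a' , e' = nrec r s (S t') , c-nrec3 (c-S a') , cong-nrec refl refl (cong S e')

  reflectᶜ-A : ∀ ρ c {d} → renμc ρ c →Ac d → Σ Cmd λ c' → (c →Ac c') × (renμc ρ c' ≡ d)
  reflectᶜ-A ρ (⟨ α ⟩ t) (c-cmd a) with reflect-A ρ t a
  ... | t' , a' , e = ⟨ α ⟩ t' , c-cmd a' , cong (⟨ ρ α ⟩_) e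

A↠AB : Term → Term → Set
A↠AB t₁ t₃ = Σ Term λ t₄ → (t₁ →A t₄) × (t₄ ↠AB t₃)

A↠AB-cong : ∀ (f : Term → Term) → (∀ {x y} → x →A y → f x →A f y) → (∀ {x y} → x →B y → f x →B f y) →
            ∀ {t u} → A↠AB t u → A↠AB (f t) (f u)
A↠AB-cong f fa fb (t₄ , a , r) = f t₄ , fa a , ↠AB-cong f fa fb r

A-then-B : ∀ {t₁ t₄ t₃} → t₁ →A t₄ → t₄ →B t₃ → A↠AB t₁ t₃
A-then-B a b = _ , a , stepB b ◅ ε

data Frame : Ctx → Set where
  app-frame  : ∀ s → Frame (appE □ s)
  suc-frame  : Frame (sucE □)
  nrec-frame : ∀ r s → Frame (nrecE r s □)

frame-μ : ∀ {F} → Frame F → ∀ c → plug F (mu c) →A mu (ssubc (keepE F) c)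
frame-μ (app-frame s) c = μapp
frame-μ suc-frame c = μS
frame-μ (nrec-frame r s) c = nrec-μ

renμ-frame : ∀ ρ {F} → Frame F → Frame (renμE ρ F)
renμ-frame ρ (app-frame s) = app-frame _
renμ-frame ρ suc-frame = suc-frame
renμ-frame ρ (nrec-frame r s) = nrec-frame _ _

-- A frame rule applied to  F[μα.[α]μβ.d]  after the μη-step: firing the
-- frame rule outside and inside, μμ then merges the two binders.
μη-in-frame : ∀ F d → ¬ (0 ∈FCV mu d) →
  ssubc (renameTo 0) (ssubc (keepE (renμE suc F)) (ssubc (liftμ (keepE F)) d)) ≡ ssubc (keepE F) (renμc (ext pred) d)
μη-in-frame F d nf = trans (cong (ssubc (renameTo 0)) (ssubc-ssubc (λ j → refl) d))
  (trans (ssubc-ssubc (λ j → refl) d) (trans (ssubc-cong-FCV d agree) (sym (ssubc-renμc (λ j → refl) d))))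
  where
    agree : ∀ j → j ∈FCVc d → (renameTo 0 ⊙ (keepE (renμE suc F) ⊙ liftμ (keepE F))) j ≡ keepE F (ext pred j)
    agree zero p = cong (0 ,_) (trans (cong (ssubE (renameTo 0)) (⊚-□ _)) (renameTo-shiftE 0 (renμE suc F)))
    agree (suc zero) p = ⊥-elim (nf (fcv-mu p))
    agree (suc (suc k)) p = refl

critical-frame : ∀ {F X Y c'} → Frame F → X →B Y → Y ≡ mu c' → A↠AB (plug F X) (mu (ssubc (keepE F) c'))
critical-frame {F} fr (c-mu {c} b) refl = mu (ssubc (keepE F) c) , frame-μ fr c , ↠AB-mu (ssubc-B (keepE F) b)
critical-frame {F} fr (μη {mu d} nf) refl =
  mu (ssubc (keepE F) (⟨ 0 ⟩ mu d)) , frame-μ fr (⟨ 0 ⟩ mu d) ,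
  stepA (c-mu (c-cmd (frame-μ (renμ-frame suc fr) (ssubc (liftμ (keepE F)) d)))) ◅
  stepB (subst (mu (⟨ 0 ⟩ mu (ssubc (keepE (renμE suc F)) (ssubc (liftμ (keepE F)) d))) →B_)
               (cong mu (μη-in-frame F d nf)) (c-mu μμ)) ◅ ε
critical-frame fr (μη {var x} nf) ()
critical-frame fr (μη {lam t} nf) ()
critical-frame fr (μη {t · s} nf) ()
critical-frame fr (μη {Z} nf) ()
critical-frame fr (μη {S t} nf) ()
critical-frame fr (μη {nrec r s t} nf) ()
critical-frame fr (c-lam b) ()
critical-frame fr (c-appl b) ()
critical-frame fr (c-appr b) ()
critical-frame fr (c-S b) ()
critical-frame fr (c-nrec1 b) ()
critical-frame fr (c-nrec2 b) ()
critical-frame fr (c-nrec3 b) ()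

-- β-redex created by B: either (μα.[α]λx.y) s, or (λx.t) s with t →B y.
critical-β : ∀ {X Y y s} → X →B Y → Y ≡ lam y → A↠AB (X · s) (sub (sub0 s) y)
critical-β {s = s} (c-lam {t} b) refl = sub (sub0 s) t , β-rule , stepB (sub-B (sub0 s) b) ◅ ε
critical-β {s = s} (μη {lam y} nf) refl =
  mu (ssubc K (⟨ 0 ⟩ lam y)) , μapp ,
  stepA (c-mu (c-cmd β-rule)) ◅ stepB (subst (mu (⟨ 0 ⟩ sub (sub0 (renμ suc s)) w) →B_) contractum (μη nf')) ◅ ε
  where
    K = keepE (appE □ s)
    w = ssub (liftλ K) y
    w≡y : w ≡ y
    w≡y = trans (ssub-cong-FCV {σ' = λ j → (j , □)} y (λ { zero p → ⊥-elim (nf (fcv-lam p)) ; (suc j) p → refl }))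
                (ssub-id (λ j → refl) y)
    contractum : renμ pred (sub (sub0 (renμ suc s)) w) ≡ sub (sub0 s) (renμ pred y)
    contractum = trans (cong (λ z → renμ pred (sub (sub0 (renμ suc s)) z)) w≡y)
                       (renμ-sub (λ { zero → renμ-pred-suc s ; (suc n) → refl }) y)
    nf' : ¬ (0 ∈FCV sub (sub0 (renμ suc s)) w)
    nf' p with FCV-sub (sub0 (renμ suc s)) y (subst (λ z → 0 ∈FCV sub (sub0 (renμ suc s)) z) w≡y p)
    ... | inj₁ q = nf (fcv-lam q)
    ... | inj₂ (zero , q) = zero∉FCV-shift s q
    nf' p | inj₂ (suc n , ())
critical-β (μη {var x} nf) ()
critical-β (μη {mu c} nf) ()
critical-β (μη {t · s} nf) ()
critical-β (μη {Z} nf) ()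
critical-β (μη {S t} nf) ()
critical-β (μη {nrec r s t} nf) ()
critical-β (c-mu b) ()
critical-β (c-appl b) ()
critical-β (c-appr b) ()
critical-β (c-S b) ()
critical-β (c-nrec1 b) ()
critical-β (c-nrec2 b) ()
critical-β (c-nrec3 b) ()

-- nrec r s X with X →B 0: only μα.[α]0 →B 0 is possible.
critical-zero : ∀ {X Y r s} → X →B Y → Y ≡ Z → A↠AB (nrec r s X) r
critical-zero {r = r} {s} (μη {t} nf) e with renμ-num-inv t zero e
... | refl = mu (⟨ 0 ⟩ nrec (renμ suc r) (renμ suc s) Z) , nrec-μ ,
             stepA (c-mu (c-cmd nrec-0)) ◅
             stepB (subst (mu (⟨ 0 ⟩ renμ suc r) →B_) (renμ-pred-suc r) (μη (zero∉FCV-shift r))) ◅ ε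
critical-zero (c-lam b) ()
critical-zero (c-mu b) ()
critical-zero (c-appl b) ()
critical-zero (c-appr b) ()
critical-zero (c-S b) ()
critical-zero (c-nrec1 b) ()
critical-zero (c-nrec2 b) ()
critical-zero (c-nrec3 b) ()

-- If y B-reduces to a numeral n̄, then S y reaches S n̄ by an A-step
-- followed by a B-step (the μ inside y is pulled over S first).
S-numeral-B : ∀ {y Y n} → y →B Y → Y ≡ num n → Σ Term λ w → (S y →A w) × (w →B S (num n))
S-numeral-B {n = n} (μη {u} nf) e with renμ-num-inv u n e
... | refl = mu (⟨ 0 ⟩ S (ssub σ (num n))) , μS , subst (mu (⟨ 0 ⟩ S (ssub σ (num n))) →B_) contractum (μη nf')
  where
    σ = keepE (sucE □)
    contractum : renμ pred (S (ssub σ (num n))) ≡ S (num n)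
    contractum = cong S (trans (cong (renμ pred) (ssub-num σ n)) (renμ-num pred n))
    nf' : ¬ (0 ∈FCV S (ssub σ (num n)))
    nf' (fcv-S p) = num-noFCV n (subst (0 ∈FCV_) (ssub-num σ n) p)
S-numeral-B {n = zero} (c-S b) ()
S-numeral-B {n = suc m} (c-S b) refl with S-numeral-B b refl
... | w , a , b' = S w , c-S a , c-S b'
S-numeral-B {n = n} (c-lam b) e with () ← numeral-head n e
S-numeral-B {n = n} (c-appl b) e with () ← numeral-head n e
S-numeral-B {n = n} (c-appr b) e with () ← numeral-head n e
S-numeral-B {n = n} (c-mu b) e with () ← numeral-head n e
S-numeral-B {n = n} (c-nrec1 b) e with () ← numeral-head n e
S-numeral-B {n = n} (c-nrec2 b) e with () ← numeral-head n e
S-numeral-B {n = n} (c-nrec3 b) e with () ← numeral-head n e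

critical-succ : ∀ {X Y r s n} → X →B Y → Y ≡ S (num n) → A↠AB (nrec r s X) ((s · num n) · nrec r s (num n))
critical-succ {r = r} {s} {n} (μη {u} nf) e with renμ-num-inv u (suc n) e
... | refl = mu (⟨ 0 ⟩ nrec r' s' (S (ssub K (num n)))) , nrec-μ , stepA inner ◅ stepB collapse ◅ ε
  where
    K = keepE (nrecE r s □)
    r' = renμ suc r
    s' = renμ suc s
    body = (s' · num n) · nrec r' s' (num n)
    inner : mu (⟨ 0 ⟩ nrec r' s' (S (ssub K (num n)))) →A mu (⟨ 0 ⟩ body)
    inner = subst (λ z → mu (⟨ 0 ⟩ nrec r' s' (S z)) →A mu (⟨ 0 ⟩ body)) (sym (ssub-num K n)) (c-mu (c-cmd (nrec-S n)))
    contractum : renμ pred body ≡ (s · num n) · nrec r s (num n)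
    contractum rewrite renμ-pred-suc r | renμ-pred-suc s | renμ-num pred n = refl
    nf' : ¬ (0 ∈FCV body)
    nf' (fcv-appl (fcv-appl p)) = zero∉FCV-shift s p
    nf' (fcv-appl (fcv-appr p)) = num-noFCV n p
    nf' (fcv-appr (fcv-nrec1 p)) = zero∉FCV-shift r p
    nf' (fcv-appr (fcv-nrec2 p)) = zero∉FCV-shift s p
    nf' (fcv-appr (fcv-nrec3 p)) = num-noFCV n p
    collapse : mu (⟨ 0 ⟩ body) →B (s · num n) · nrec r s (num n)
    collapse = subst (mu (⟨ 0 ⟩ body) →B_) contractum (μη nf')
critical-succ {r = r} {s} {n} (c-S b) refl with S-numeral-B b refl
... | w , a , b' = nrec r s w , c-nrec3 a , stepB (c-nrec3 b') ◅ stepA (nrec-S n) ◅ ε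
critical-succ (c-lam b) ()
critical-succ (c-mu b) ()
critical-succ (c-appl b) ()
critical-succ (c-appr b) ()
critical-succ (c-nrec1 b) ()
critical-succ (c-nrec2 b) ()
critical-succ (c-nrec3 b) ()

mutual
  commute : ∀ {t₁ t₂ t₃} → t₁ →B t₂ → t₂ →A t₃ → A↠AB t₁ t₃
  commute (μη nf) a = commute-μη nf a
  commute (c-lam b) (c-lam a) = A↠AB-cong lam c-lam c-lam (commute b a)
  commute (c-appl b) a = commute-appl b a
  commute (c-appr b) a = commute-appr b a
  commute (c-mu b) (c-mu a) with commuteᶜ b a
  ... | c₄ , a' , r = mu c₄ , c-mu a' , ↠AB-mu r
  commute (c-S b) (c-S a) = A↠AB-cong S c-S c-S (commute b a)
  commute (c-S b) μS = critical-frame suc-frame b refl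
  commute (c-nrec1 b) a = commute-nrec1 b a
  commute (c-nrec2 b) a = commute-nrec2 b a
  commute (c-nrec3 b) a = commute-nrec3 b a

  -- μα.[α]t →B t↓ →A t₃: the A-step is reflected to t before contracting.
  commute-μη : ∀ {t t₃} → ¬ (0 ∈FCV t) → renμ pred t →A t₃ → A↠AB (mu (⟨ 0 ⟩ t)) t₃
  commute-μη {t} nf a with reflect-A pred t a
  ... | t' , a' , e = A-then-B (c-mu (c-cmd a')) (subst (mu (⟨ 0 ⟩ t') →B_) e (μη (λ p → nf (A-FCV a' p))))

  commute-appl : ∀ {t t' s u} → t →B t' → t' · s →A u → A↠AB (t · s) u
  commute-appl {s = s} b (c-appl a) = A↠AB-cong (_· s) c-appl c-appl (commute b a)
  commute-appl b (c-appr a) = A-then-B (c-appr a) (c-appl b)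
  commute-appl b β-rule = critical-β b refl
  commute-appl b μapp = critical-frame (app-frame _) b refl

  commute-appr : ∀ {t s s' u} → s →B s' → t · s' →A u → A↠AB (t · s) u
  commute-appr b (c-appl a) = A-then-B (c-appl a) (c-appr b)
  commute-appr {t} b (c-appr a) = A↠AB-cong (t ·_) c-appr c-appr (commute b a)
  commute-appr {s = s} {s'} b (β-rule {t = t}) = sub (sub0 s) t , β-rule , ↠B⇒↠AB (sub-↠B argument t)
    where argument : ∀ n → sub0 s n ↠B sub0 s' n
          argument zero = b ◅ ε
          argument (suc n) = ε
  commute-appr b (μapp {c = c}) = _ , μapp , ↠B⇒↠AB (keepE-↠B (appE □ (b ◅ ε)) c)

  commute-nrec1 : ∀ {r r' s t u} → r →B r' → nrec r' s t →A u → A↠AB (nrec r s t) u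
  commute-nrec1 {s = s} {t} b (c-nrec1 a) = A↠AB-cong (λ x → nrec x s t) c-nrec1 c-nrec1 (commute b a)
  commute-nrec1 b (c-nrec2 a) = A-then-B (c-nrec2 a) (c-nrec1 b)
  commute-nrec1 b (c-nrec3 a) = A-then-B (c-nrec3 a) (c-nrec1 b)
  commute-nrec1 b nrec-0 = A-then-B nrec-0 b
  commute-nrec1 b (nrec-S n) = A-then-B (nrec-S n) (c-appr (c-nrec1 b))
  commute-nrec1 b (nrec-μ {c = c}) = _ , nrec-μ , ↠B⇒↠AB (keepE-↠B (nrecE (b ◅ ε) ε □) c)

  commute-nrec2 : ∀ {r s s' t u} → s →B s' → nrec r s' t →A u → A↠AB (nrec r s t) u
  commute-nrec2 b (c-nrec1 a) = A-then-B (c-nrec1 a) (c-nrec2 b)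
  commute-nrec2 {r} {t = t} b (c-nrec2 a) = A↠AB-cong (λ x → nrec r x t) c-nrec2 c-nrec2 (commute b a)
  commute-nrec2 b (c-nrec3 a) = A-then-B (c-nrec3 a) (c-nrec2 b)
  commute-nrec2 b nrec-0 = _ , nrec-0 , ε
  commute-nrec2 b (nrec-S n) = _ , nrec-S n , stepB (c-appl (c-appl b)) ◅ stepB (c-appr (c-nrec2 b)) ◅ ε
  commute-nrec2 b (nrec-μ {c = c}) = _ , nrec-μ , ↠B⇒↠AB (keepE-↠B (nrecE ε (b ◅ ε) □) c)

  commute-nrec3 : ∀ {r s t t' u} → t →B t' → nrec r s t' →A u → A↠AB (nrec r s t) u
  commute-nrec3 b (c-nrec1 a) = A-then-B (c-nrec1 a) (c-nrec3 b)
  commute-nrec3 b (c-nrec2 a) = A-then-B (c-nrec2 a) (c-nrec3 b)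
  commute-nrec3 {r} {s} b (c-nrec3 a) = A↠AB-cong (nrec r s) c-nrec3 c-nrec3 (commute b a)
  commute-nrec3 b nrec-0 = critical-zero b refl
  commute-nrec3 b (nrec-S n) = critical-succ b refl
  commute-nrec3 b nrec-μ = critical-frame (nrec-frame _ _) b refl

  -- On commands; for μμ the A-step is reflected along the renaming
  -- underlying [β := α□].
  commuteᶜ : ∀ {c₁ c₂ c₃} → c₁ →Bc c₂ → c₂ →Ac c₃ → Σ Cmd λ c₄ → (c₁ →Ac c₄) × (c₄ ↠ABc c₃)
  commuteᶜ (μμ {α} {d}) a with reflectᶜ-A (contract α) d (subst (_→Ac _) (ssubc-renaming (renameTo-renaming α) d) a)
  ... | d' , a' , e = ⟨ α ⟩ mu d' , c-cmd (c-mu a') ,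
                      cB (subst (⟨ α ⟩ mu d' →Bc_) (trans (ssubc-renaming (renameTo-renaming α) d') e) μμ) ◅ ε
  commuteᶜ (c-cmd {α} b) (c-cmd a) with commute b a
  ... | t₄ , a' , r = ⟨ α ⟩ t₄ , c-cmd a' , ↠AB-cmd α r

lemma6p31 : (t₁ t₂ t₃ : Term) → t₁ →B t₂ → t₂ →A t₃ →
            Σ Term (λ t₄ → (t₁ →A t₄) × (t₄ ↠AB t₃))
lemma6p31 t₁ t₂ t₃ b a = commute b a
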